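{- Let $V,E,C$ be pairwise disjoint subsets of $\{1,2,3,\dots\}$. Let $\phi:\Lambda\to\widetilde\Lambda$ be the algebra homomorphism (ordinary product on $\Lambda$, $\odot$ on $\widetilde\Lambda$) with $\phi(p_n)=\widetilde m_n$ for $n\in V$, $\phi(p_n)=-\widetilde m_n$ for $n\in E$, $\phi(p_n)=0$ for $n\in C$, and let $\theta:\widetilde\Lambda\to\widetilde\Lambda$ be the $\odot$-algebra homomorphism with $\theta(\widetilde m_n)=\widetilde m_n$ for $n\in V\cup E$ and $\theta(\widetilde m_n)=0$ for $n\in C$ (for $n\notin V\cup E\cup C$, $\phi(p_n)$ and $\theta(\widetilde m_n)$ are arbitrary scalar multiples of $\widetilde m_n$). Then $\phi(X_G)=\theta(X_{\overline{G}})$ for every weighted graph $G$ whose vertex weights all lie in $V$, whose edge weights (sums of the weights of the two endpoints) all lie in $E$, and such that the total weight of every $S\subseteq V(G)$ with $|S|\ge3$ and $G|_S$ connected lies in $C$.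
   Context: Work over a field $\mathbb{K}$ of characteristic $0$. Weighted graph: finite simple graph with vertex weights in $\{1,2,\dots\}$; $\overline{G}$ complement; $X_G=\sum_\kappa\prod_v x_{\kappa(v)}^{w(v)}$ over proper colorings $\kappa$. $\Lambda$ is the ring of symmetric functions, $p_n=\sum_ix_i^n$. $\widetilde m_\lambda=m_\lambda\prod_i r_i(\lambda)!$, $\widetilde m_n=p_n$. $\widetilde\Lambda$ is the vector space $\Lambda$ with product $\odot$ given by $\widetilde m_\lambda\odot\widetilde m_\mu=\widetilde m_{\lambda\sqcup\mu}$ ($\lambda\sqcup\mu$ union of parts); its $\widetilde m_n$ are algebraically independent generators. -}

module Defs where

open import Level using (Level; _⊔_) renaming (suc to lsuc)
open import Data.Nat using (ℕ; zero; suc; _∸_; _<_; _≡ᵇ_)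
open import Data.Bool using (Bool; true; false; not; _∧_; if_then_else_)
open import Data.Fin using (Fin; _≟_)
open import Data.Fin.Subset using (Subset; _∈_)
open import Data.List using (List; []; _∷_; map; concatMap; upTo; allFin; foldr; filterᵇ; length; lookup; _++_)
open import Data.Bool.ListAction using (and)
open import Data.Nat.ListAction using (sum)
import Data.List as L
open import Data.Vec using (Vec)
import Data.Vec as V
open import Data.Product using (_×_; _,_; ∃)
open import Relation.Nullary using (¬_; does; yes; no)
open import Relation.Binary.PropositionalEquality using (_≡_; refl; sym)
open import Data.List.Relation.Binary.Permutation.Propositional using (_↭_)
open import Algebra.Bundles using (CommutativeRing)

record Field (c ℓ : Level) : Set (lsuc (c ⊔ ℓ)) where
  field
    commutativeRing : CommutativeRing c ℓ
  open CommutativeRing commutativeRing public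
  field
    1≉0 : ¬ (1# ≈ 0#)
    inverse : ∀ x → ¬ (x ≈ 0#) → ∃ λ y → (x * y) ≈ 1#

module FieldOps {c ℓ : Level} (F : Field c ℓ) where
  open Field F

  fromℕ : ℕ → Carrier
  fromℕ zero = 0#
  fromℕ (suc n) = 1# + fromℕ n

  CharZero : Set ℓ
  CharZero = ∀ n → ¬ (fromℕ (suc n) ≈ 0#)

  sumK : List Carrier → Carrier
  sumK = foldr _+_ 0#

-- Formal power series in x₁, x₂, x₃, … with coefficients in 𝕂.
-- A monomial x^α is given by a finite exponent list α = (α₁,…,αₖ)
-- (the exponents of x₁,…,xₖ; all further exponents are 0).  Lists differing by trailing zeros denote
-- the same monomial; the elements of Λ below are required to respect this.

module SymFun {c ℓ : Level} (F : Field c ℓ) where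
  open Field F
  open FieldOps F public

  Series : Set c
  Series = List ℕ → Carrier

  infix 4 _≈ˢ_
  _≈ˢ_ : Series → Series → Set ℓ
  f ≈ˢ g = ∀ α → f α ≈ g α

  0ˢ : Series
  0ˢ _ = 0#

  isZeroMon : List ℕ → Bool
  isZeroMon α = and (map (λ a → a ≡ᵇ 0) α)

  1ˢ : Series
  1ˢ α = if isZeroMon α then 1# else 0#

  _+ˢ_ : Series → Series → Series
  (f +ˢ g) α = f α + g α

  -ˢ_ : Series → Series
  (-ˢ f) α = - f α

  _•_ : Carrier → Series → Series
  (a • f) α = a * f α

  splits : List ℕ → List (List ℕ × List ℕ)
  splits [] = ([] , []) ∷ []
  splits (a ∷ α) =
    concatMap (λ i → map (λ p → (i ∷ Data.Product.proj₁ p) , ((a ∸ i) ∷ Data.Product.proj₂ p)) (splits α))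
              (upTo (suc a))

  _·ˢ_ : Series → Series → Series
  (f ·ˢ g) α = sumK (map (λ p → f (Data.Product.proj₁ p) * g (Data.Product.proj₂ p)) (splits α))

  subseqSplits : List ℕ → List (List ℕ × List ℕ)
  subseqSplits [] = ([] , []) ∷ []
  subseqSplits (a ∷ α) =
    concatMap (λ p → ((a ∷ Data.Product.proj₁ p) , Data.Product.proj₂ p)
                   ∷ (Data.Product.proj₁ p , (a ∷ Data.Product.proj₂ p)) ∷ [])
              (subseqSplits α)

  nonzeroParts : List ℕ → List ℕ
  nonzeroParts = filterᵇ (λ a → not (a ≡ᵇ 0))

  -- The product ⊙ of Λ̃ (bilinear extension of m̃_λ ⊙ m̃_μ = m̃_{λ⊔μ}),
  -- written out on coefficients: for symmetric f, g the coefficient of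
  -- x^α in f ⊙ g is the sum over all splittings of the multiset of
  -- nonzero exponents of α into two sub-multisets (counted as
  -- subsequences) of f(first part)·g(second part).
  _⊙_ : Series → Series → Series
  (f ⊙ g) α = sumK (map (λ p → f (Data.Product.proj₁ p) * g (Data.Product.proj₂ p))
                        (subseqSplits (nonzeroParts α)))

  -- p_n = Σ_i x_i^n  (= m̃_n)
  pˢ : ℕ → Series
  pˢ n α with nonzeroParts α
  ... | a ∷ [] = if a ≡ᵇ n then 1# else 0#
  ... | _ = 0#

  record IsΛ (f : Series) : Set (c ⊔ ℓ) where
    field
      padding   : ∀ α → f (α ++ 0 ∷ []) ≈ f α
      symmetric : ∀ α β → α ↭ β → f α ≈ f β
      bounded   : ∃ λ d → ∀ α → d < sum α → f α ≈ 0#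

  -- φ : Λ → Λ̃ a 𝕂-algebra homomorphism (ordinary product → ⊙).
  -- φ is given as a map on series; only its behaviour on Λ matters.
  record IsHomΛΛ̃ (φ : Series → Series) : Set (c ⊔ ℓ) where
    field
      resp  : ∀ f g → IsΛ f → IsΛ g → f ≈ˢ g → φ f ≈ˢ φ g
      additive : ∀ f g → IsΛ f → IsΛ g → φ (f +ˢ g) ≈ˢ φ f +ˢ φ g
      homogeneous : ∀ a f → IsΛ f → φ (a • f) ≈ˢ a • φ f
      multiplicative : ∀ f g → IsΛ f → IsΛ g → φ (f ·ˢ g) ≈ˢ φ f ⊙ φ g
      unital : φ 1ˢ ≈ˢ 1ˢ

  record IsHomΛ̃Λ̃ (θ : Series → Series) : Set (c ⊔ ℓ) where
    field
      resp  : ∀ f g → IsΛ f → IsΛ g → f ≈ˢ g → θ f ≈ˢ θ g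
      additive : ∀ f g → IsΛ f → IsΛ g → θ (f +ˢ g) ≈ˢ θ f +ˢ θ g
      homogeneous : ∀ a f → IsΛ f → θ (a • f) ≈ˢ a • θ f
      multiplicative : ∀ f g → IsΛ f → IsΛ g → θ (f ⊙ g) ≈ˢ θ f ⊙ θ g
      unital : θ 1ˢ ≈ˢ 1ˢ

record WGraph : Set where
  field
    n      : ℕ
    adj    : Fin n → Fin n → Bool
    adj-sym : ∀ u v → adj u v ≡ adj v u
    adj-irrefl : ∀ v → adj v v ≡ false
    w      : Fin n → ℕ
    w-pos  : ∀ v → 1 Data.Nat.≤ w v

open WGraph public

compAdj : (G : WGraph) → Fin (n G) → Fin (n G) → Bool
compAdj G u v with u ≟ v
... | yes _ = false
... | no _ = not (adj G u v)

compAdj-sym : (G : WGraph) → ∀ u v → compAdj G u v ≡ compAdj G v u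
compAdj-sym G u v with u ≟ v | v ≟ u
... | yes _ | yes _ = refl
... | yes refl | no ¬p = Data.Empty.⊥-elim (¬p refl)
  where import Data.Empty
... | no ¬p | yes refl = Data.Empty.⊥-elim (¬p refl)
  where import Data.Empty
... | no _ | no _ rewrite adj-sym G u v = refl

compAdj-irrefl : (G : WGraph) → ∀ v → compAdj G v v ≡ false
compAdj-irrefl G v with v ≟ v
... | yes _ = refl
... | no ¬p = Data.Empty.⊥-elim (¬p refl)
  where import Data.Empty

complement : WGraph → WGraph
complement G = record
  { n = n G ; adj = compAdj G ; adj-sym = compAdj-sym G
  ; adj-irrefl = compAdj-irrefl G ; w = w G ; w-pos = w-pos G }

allVecs : (k m : ℕ) → List (Vec (Fin m) k)
allVecs zero m = V.[] ∷ []
allVecs (suc k) m = concatMap (λ v → map (λ i → i V.∷ v) (allFin m)) (allVecs k m)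

isProper : (G : WGraph) {m : ℕ} → Vec (Fin m) (n G) → Bool
isProper G κ =
  and (map (λ u → and (map (λ v →
        if adj G u v then not (does (V.lookup κ u ≟ V.lookup κ v)) else true)
      (allFin (n G)))) (allFin (n G)))

colourWeight : (G : WGraph) {m : ℕ} → Vec (Fin m) (n G) → Fin m → ℕ
colourWeight G κ i =
  sum (map (λ v → if does (V.lookup κ v ≟ i) then w G v else 0) (allFin (n G)))

-- ∏_v x_{κ(v)}^{w(v)} = x^α   (colour i ↦ variable x_(i+1))
hasMonomial : (G : WGraph) (α : List ℕ) → Vec (Fin (length α)) (n G) → Bool
hasMonomial G α κ = and (map (λ i → lookup α i ≡ᵇ colourWeight G κ i) (allFin (length α)))

-- number of proper colourings κ : V(G) → {1,2,…} with ∏ x_{κ(v)}^{w(v)} = x^α.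
-- Since all weights are positive, such κ only use colours 1,…,length α.
countColourings : WGraph → List ℕ → ℕ
countColourings G α =
  length (filterᵇ (λ κ → isProper G κ ∧ hasMonomial G α κ) (allVecs (n G) (length α)))

module Chromatic {c ℓ : Level} (F : Field c ℓ) where
  open SymFun F
  X : WGraph → Series
  X G α = fromℕ (countColourings G α)

-- a walk from u to v staying inside S (u itself need not be checked)
data ReachIn (G : WGraph) (S : Subset (n G)) : Fin (n G) → Fin (n G) → Set where
  here : ∀ {u} → ReachIn G S u u
  step : ∀ {u x v} → adj G u x ≡ true → x ∈ S → ReachIn G S x v → ReachIn G S u v

InducedConnected : (G : WGraph) → Subset (n G) → Set
InducedConnected G S = ∀ u v → u ∈ S → v ∈ S → ReachIn G S u v

weightOf : (G : WGraph) → Subset (n G) → ℕ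
weightOf G S = sum (map (λ v → if V.lookup S v then w G v else 0) (allFin (n G)))

{-# OPTIONS --safe #-}
module Submission where

-- Both sides are values of graph invariants Ψ with Ψ(H) = Ψ(H ∖ e) + σ Ψ(H / e) and
-- Ψ(H) = ψ(p_w) ⊙ Ψ(H − v) for an isolated vertex v of weight w.  For Ψ = φ ∘ X these are
-- deletion–contraction (σ = −1) and X_H = p_w X_{H−v}; for Ψ = θ ∘ X ∘ complement they are
-- the same identities read in the complement (σ = 1), where v becomes a dominating vertex
-- and X_H = p_w ⊙ X_{H−v}.  Deleting or contracting the edges at a vertex v one at a time,
-- the contracted vertex stands for a connected vertex set Z of G, so by the hypotheses on
-- V, E, C the factor ψ(p_{w(Z)}) is p, σ p or 0 for |Z| = 1, 2, ≥ 3, and σ² = 1 cancels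
-- the sign of the contraction.  Hence both invariants satisfy
--   Ψ(H) = p_{w(v)} ⊙ Ψ(H − v) + Σ_{u ∼ v} p_{w(v) + w(u)} ⊙ Ψ(H − v − u)
-- on induced subgraphs H of G, and they agree by induction on the number of vertices.

open import Level using (Level; _⊔_)
open import Algebra.Bundles using (CommutativeSemiring)
open import Data.Bool using (Bool; true; false; not; _∧_; _∨_; if_then_else_)
open import Data.Bool.ListAction using (and)
open import Data.Bool.Properties using (∨-zeroʳ; ∨-identityʳ; ∧-zeroʳ; ∧-identityʳ; ∧-assoc; ∧-conicalˡ; ∧-conicalʳ)
open import Data.Empty using (⊥)
import Data.Fin as Fin
open import Data.Fin using (Fin; zero; suc; _≟_)
open import Data.Fin.Permutation using (Permutation′; transpose; lift₀)
import Data.Fin.Permutation.Components as PC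
import Data.Fin.Properties as Finₚ
open import Data.Fin.Subset using (Subset; _∈_; _∉_; ⁅_⁆; _∪_; ∣_∣) renaming (⊥ to ∅)
open import Data.Fin.Subset.Properties using (∪-identityʳ; x∈p∪q⁻; p⊆p∪q; q⊆p∪q; x∈⁅y⁆⇒x≡y; x∈⁅x⁆; ∣⁅x⁆∣≡1)
open import Data.List using (List; []; _∷_; [_]; lookup; map; concatMap; allFin; upTo; replicate; foldr; filterᵇ; length; null; _++_)
import Data.List.Properties as Listₚ
open import Data.List.Relation.Binary.Permutation.Propositional
  using (_↭_; prep; swap; ↭-sym) renaming (refl to ↭-refl; trans to ↭-trans)
open import Data.List.Relation.Binary.Permutation.Propositional.Properties
  using (↭-length; shift; ↭-empty-inv; ↭-singleton-inv; filter-↭; ++-comm)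
import Data.Nat as ℕ
open import Data.Nat using (ℕ; zero; suc; _≤_; _≡ᵇ_; _<ᵇ_)
open import Data.Nat.ListAction using (sum)
open import Data.Nat.Properties using (+-*-commutativeSemiring)
import Data.Nat.Properties as ℕₚ
open import Data.Product using (_×_; _,_; proj₁; proj₂; ∃; ∃-syntax)
open import Data.Sum using (_⊎_; inj₁; inj₂)
open import Data.Vec using (Vec; []; _∷_; here; there)
import Data.Vec as Vec
import Data.Vec.Properties as Vecₚ
open import Function using (_∘_; id; _↔_; _⇔_; Inverse; mk⇔; mk↔ₛ′)
open import Relation.Binary.Bundles using (Setoid)
open import Relation.Binary.Definitions using (DecidableEquality)
open import Relation.Binary.PropositionalEquality as ≡ using (_≡_; _≢_)
open import Relation.Nullary using (Dec; does; yes; no)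
open import Relation.Nullary.Decidable using (dec-true; dec-false; does-⇔; T?; _×-dec_)
open import Relation.Nullary.Negation using (contradiction)

open import Defs

map-allFin-suc : ∀ {b} {B : Set b} n (f : Fin (suc n) → B) →
  map f (allFin (suc n)) ≡ f zero ∷ map (f ∘ suc) (allFin n)
map-allFin-suc n f = ≡.cong (f zero ∷_) (≡.trans (Listₚ.map-tabulate suc f) (≡.sym (Listₚ.map-tabulate id (f ∘ suc))))

module ListSum {c ℓ} (R : CommutativeSemiring c ℓ) where
  open CommutativeSemiring R hiding (zero)
  open import Algebra.Properties.CommutativeSemigroup +-commutativeSemigroup using (interchange)

  ∑ : {A : Set} → List A → (A → Carrier) → Carrier
  ∑ xs f = foldr _+_ 0# (map f xs)

  module _ {A : Set} where

    ∑-cong : ∀ (xs : List A) {f g} → (∀ x → f x ≈ g x) → ∑ xs f ≈ ∑ xs g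
    ∑-cong []       f≈g = refl
    ∑-cong (x ∷ xs) f≈g = +-cong (f≈g x) (∑-cong xs f≈g)

    ∑-zero : ∀ (xs : List A) {f} → (∀ x → f x ≈ 0#) → ∑ xs f ≈ 0#
    ∑-zero []       f≈0 = refl
    ∑-zero (x ∷ xs) f≈0 = trans (+-cong (f≈0 x) (∑-zero xs f≈0)) (+-identityˡ 0#)

    ∑-++ : ∀ (xs ys : List A) f → ∑ (xs ++ ys) f ≈ ∑ xs f + ∑ ys f
    ∑-++ []       ys f = sym (+-identityˡ _)
    ∑-++ (x ∷ xs) ys f = trans (+-congˡ (∑-++ xs ys f)) (sym (+-assoc _ _ _))

    ∑-+ : ∀ (xs : List A) f g → ∑ xs (λ x → f x + g x) ≈ ∑ xs f + ∑ xs g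
    ∑-+ []       f g = sym (+-identityˡ 0#)
    ∑-+ (x ∷ xs) f g = trans (+-congˡ (∑-+ xs f g)) (interchange _ _ _ _)

    ∑-*ˡ : ∀ (xs : List A) a f → ∑ xs (λ x → a * f x) ≈ a * ∑ xs f
    ∑-*ˡ []       a f = sym (zeroʳ a)
    ∑-*ˡ (x ∷ xs) a f = trans (+-congˡ (∑-*ˡ xs a f)) (sym (distribˡ a _ _))

    ∑-*ʳ : ∀ (xs : List A) a f → ∑ xs (λ x → f x * a) ≈ ∑ xs f * a
    ∑-*ʳ xs a f = trans (∑-cong xs (λ x → *-comm (f x) a)) (trans (∑-*ˡ xs a f) (*-comm a _))

  ∑-map : ∀ {A B : Set} (g : A → B) xs f → ∑ (map g xs) f ≡ ∑ xs (f ∘ g)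
  ∑-map g xs f = ≡.cong (foldr _+_ 0#) (≡.sym (Listₚ.map-∘ xs))

  ∑-concatMap : ∀ {A B : Set} (g : A → List B) xs f → ∑ (concatMap g xs) f ≈ ∑ xs (λ x → ∑ (g x) f)
  ∑-concatMap g []       f = refl
  ∑-concatMap g (x ∷ xs) f = trans (∑-++ (g x) _ f) (+-congˡ (∑-concatMap g xs f))

  ∑-swap : ∀ {A B : Set} (xs : List A) (ys : List B) (f : A → B → Carrier) →
    ∑ xs (λ x → ∑ ys (f x)) ≈ ∑ ys (λ y → ∑ xs (λ x → f x y))
  ∑-swap []       ys f = sym (∑-zero ys (λ _ → refl))
  ∑-swap (x ∷ xs) ys f = trans (+-congˡ (∑-swap xs ys f)) (sym (∑-+ ys (f x) _))

  ∑-allFin-suc : ∀ n (f : Fin (suc n) → Carrier) → ∑ (allFin (suc n)) f ≡ f zero + ∑ (allFin n) (f ∘ suc)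
  ∑-allFin-suc n f = ≡.cong (foldr _+_ 0#) (map-allFin-suc n f)

  ∑-upTo-suc : ∀ a (f : ℕ → Carrier) → ∑ (upTo (suc a)) f ≡ f 0 + ∑ (upTo a) (f ∘ suc)
  ∑-upTo-suc a f = ≡.cong (f 0 +_) (≡.trans (≡.cong (λ js → ∑ js f) (≡.sym (Listₚ.map-applyUpTo id suc a))) (∑-map suc (upTo a) f))

  ∑-upTo-select : ∀ a k (g : ℕ → Carrier) → ∑ (upTo a) (λ j → if j ≡ᵇ k then g j else 0#) ≈ (if k <ᵇ a then g k else 0#)
  ∑-upTo-select zero    k       g = refl
  ∑-upTo-select (suc a) zero    g = trans (reflexive (∑-upTo-suc a _))
                                          (trans (+-congˡ (∑-zero (upTo a) (λ _ → refl))) (+-identityʳ (g 0)))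
  ∑-upTo-select (suc a) (suc k) g = trans (reflexive (∑-upTo-suc a _)) (trans (+-identityˡ _) (∑-upTo-select a k (g ∘ suc)))

module Counting where
  open import Data.Nat using (_+_; _*_)
  open import Data.Nat.Properties using (+-identityʳ; m≤m+n; m≤n+m; ≤-trans)
  open ≡ hiding ([_])
  open ≡-Reasoning
  open ListSum +-*-commutativeSemiring public

  𝟙 : Bool → ℕ
  𝟙 true  = 1
  𝟙 false = 0

  𝟙-∧ : ∀ a b → 𝟙 (a ∧ b) ≡ 𝟙 a * 𝟙 b
  𝟙-∧ true  b = sym (+-identityʳ (𝟙 b))
  𝟙-∧ false b = refl

  length-filterᵇ : ∀ {A : Set} (p : A → Bool) xs → length (filterᵇ p xs) ≡ ∑ xs (𝟙 ∘ p)
  length-filterᵇ p [] = refl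
  length-filterᵇ p (x ∷ xs) with p x
  ... | true  = cong suc (length-filterᵇ p xs)
  ... | false = length-filterᵇ p xs

  ∧-swap : ∀ a b c → a ∧ (b ∧ c) ≡ b ∧ (a ∧ c)
  ∧-swap true  b c = refl
  ∧-swap false b c = sym (∧-zeroʳ b)

  ∨-true⁻ : ∀ {a b} → a ∨ b ≡ true → a ≡ true ⊎ b ≡ true
  ∨-true⁻ {true}  _ = inj₁ refl
  ∨-true⁻ {false} b = inj₂ b

  ∨-trueʳ : ∀ a {b} → b ≡ true → a ∨ b ≡ true
  ∨-trueʳ a refl = ∨-zeroʳ a

  Bool-ext : ∀ {a b : Bool} → (a ≡ true → b ≡ true) → (b ≡ true → a ≡ true) → a ≡ b
  Bool-ext {true}  {b}     a⇒b b⇒a = sym (a⇒b refl)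
  Bool-ext {false} {true}  a⇒b b⇒a = b⇒a refl
  Bool-ext {false} {false} a⇒b b⇒a = refl

  witness : ∀ {P : Set} (P? : Dec P) → does P? ≡ true → P
  witness (yes p) _ = p

  ∧-true⁻ : ∀ {a b} → a ∧ b ≡ true → a ≡ true × b ≡ true
  ∧-true⁻ {a} {b} ab = ∧-conicalˡ a b ab , ∧-conicalʳ a b ab

  and-allFin-suc : ∀ n (f : Fin (suc n) → Bool) → and (map f (allFin (suc n))) ≡ f zero ∧ and (map (f ∘ suc) (allFin n))
  and-allFin-suc n f = cong and (map-allFin-suc n f)

  and-allFin⁺ : ∀ n (f : Fin n → Bool) → (∀ i → f i ≡ true) → and (map f (allFin n)) ≡ true
  and-allFin⁺ zero    f all = refl
  and-allFin⁺ (suc n) f all = trans (and-allFin-suc n f) (cong₂ _∧_ (all zero) (and-allFin⁺ n (f ∘ suc) (all ∘ suc)))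

  and-allFin⁻ : ∀ n (f : Fin n → Bool) → and (map f (allFin n)) ≡ true → ∀ i → f i ≡ true
  and-allFin⁻ (suc n) f all i with ∧-true⁻ {f zero} (trans (sym (and-allFin-suc n f)) all)
  and-allFin⁻ (suc n) f all zero    | f₀ , _    = f₀
  and-allFin⁻ (suc n) f all (suc i) | _  , rest = and-allFin⁻ n (f ∘ suc) rest i

  ∑-allVecs-suc : ∀ n c (f : Vec (Fin c) (suc n) → ℕ) →
    ∑ (allVecs (suc n) c) f ≡ ∑ (allVecs n c) (λ v → ∑ (allFin c) (λ i → f (i ∷ v)))
  ∑-allVecs-suc n c f = trans (∑-concatMap _ (allVecs n c) f)
    (∑-cong (allVecs n c) (λ v → ∑-map (_∷ v) (allFin c) f))

  ∑-allFin-≥ : ∀ n (f : Fin n → ℕ) x → f x ≤ ∑ (allFin n) f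
  ∑-allFin-≥ (suc n) f zero    rewrite ∑-allFin-suc n f = m≤m+n _ _
  ∑-allFin-≥ (suc n) f (suc x) rewrite ∑-allFin-suc n f = ≤-trans (∑-allFin-≥ n (f ∘ suc) x) (m≤n+m _ _)

  record Enumeration (A : Set) : Set where
    field
      elements         : List A
      decEq            : DecidableEquality A
      multiplicity-one : ∀ a → ∑ elements (λ x → 𝟙 (does (decEq x a))) ≡ 1

  module _ {A : Set} (E : Enumeration A) where
    open Enumeration E

    ∑-select : ∀ a (f : A → ℕ) → ∑ elements (λ x → 𝟙 (does (decEq x a)) * f x) ≡ f a
    ∑-select a f = begin
      ∑ elements (λ x → 𝟙 (does (decEq x a)) * f x) ≡⟨ ∑-cong elements at-a ⟩
      ∑ elements (λ x → 𝟙 (does (decEq x a)) * f a) ≡⟨ ∑-*ʳ elements (f a) _ ⟩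
      ∑ elements (λ x → 𝟙 (does (decEq x a))) * f a ≡⟨ cong (_* f a) (multiplicity-one a) ⟩
      1 * f a                                        ≡⟨ +-identityʳ (f a) ⟩
      f a                                            ∎
      where
      at-a : ∀ x → 𝟙 (does (decEq x a)) * f x ≡ 𝟙 (does (decEq x a)) * f a
      at-a x with decEq x a
      ... | yes refl = refl
      ... | no _     = refl

  ∑-reindex : ∀ {A B : Set} (EA : Enumeration A) (EB : Enumeration B) (π : A ↔ B) (f : B → ℕ) →
    ∑ (Enumeration.elements EA) (f ∘ Inverse.to π) ≡ ∑ (Enumeration.elements EB) f
  ∑-reindex EA EB π f = begin
    ∑ as (f ∘ to)
      ≡⟨ ∑-cong as (λ x → sym (∑-select EB (to x) f)) ⟩
    ∑ as (λ x → ∑ bs (λ y → 𝟙 (does (y ≟B to x)) * f y))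
      ≡⟨ ∑-swap as bs _ ⟩
    ∑ bs (λ y → ∑ as (λ x → 𝟙 (does (y ≟B to x)) * f y))
      ≡⟨ ∑-cong bs (λ y → ∑-*ʳ as (f y) _) ⟩
    ∑ bs (λ y → ∑ as (λ x → 𝟙 (does (y ≟B to x))) * f y)
      ≡⟨ ∑-cong bs (λ y → cong (_* f y) (trans (∑-cong as (λ x → cong 𝟙 (swap-sides x y)))
                                                (Enumeration.multiplicity-one EA (from y)))) ⟩
    ∑ bs (λ y → 1 * f y)
      ≡⟨ ∑-cong bs (λ y → +-identityʳ (f y)) ⟩
    ∑ bs f ∎
    where
    open Inverse π
    open Enumeration EA using () renaming (elements to as; decEq to _≟A_)
    open Enumeration EB using () renaming (elements to bs; decEq to _≟B_)
    swap-sides : ∀ x y → does (y ≟B to x) ≡ does (x ≟A from y)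
    swap-sides x y = does-⇔ (mk⇔ (λ y≡tx → trans (sym (strictlyInverseʳ x)) (cong from (sym y≡tx)))
                                (λ x≡fy → trans (sym (strictlyInverseˡ y)) (cong to (sym x≡fy))))
                           (y ≟B to x) (x ≟A from y)

  finEnumeration : ∀ n → Enumeration (Fin n)
  finEnumeration n = record { elements = allFin n ; decEq = _≟_ ; multiplicity-one = once n }
    where
    once : ∀ n (a : Fin n) → ∑ (allFin n) (λ x → 𝟙 (does (x ≟ a))) ≡ 1
    once (suc n) zero    = trans (∑-allFin-suc n (λ x → 𝟙 (does (x ≟ zero))))
                                 (cong suc (∑-zero (allFin n) (λ _ → refl)))
    once (suc n) (suc a) = trans (∑-allFin-suc n (λ x → 𝟙 (does (x ≟ suc a)))) (once n a)

  vecEnumeration : ∀ n c → Enumeration (Vec (Fin c) n)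
  vecEnumeration n c = record { elements = allVecs n c ; decEq = Vecₚ.≡-dec _≟_ ; multiplicity-one = once n }
    where
    _≟ᵥ_ : ∀ {n} → DecidableEquality (Vec (Fin c) n)
    _≟ᵥ_ = Vecₚ.≡-dec _≟_
    once : ∀ n (a : Vec (Fin c) n) → ∑ (allVecs n c) (λ x → 𝟙 (does (x ≟ᵥ a))) ≡ 1
    once zero    []      = refl
    once (suc n) (j ∷ a) = begin
      ∑ (allVecs (suc n) c) (λ x → 𝟙 (does (x ≟ᵥ (j ∷ a))))
        ≡⟨ ∑-allVecs-suc n c _ ⟩
      ∑ (allVecs n c) (λ v → ∑ (allFin c) (λ i → 𝟙 (does (i ≟ j) ∧ does (v ≟ᵥ a))))
        ≡⟨ ∑-cong (allVecs n c) (λ v → trans (∑-cong (allFin c) (λ i → 𝟙-∧ (does (i ≟ j)) _))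
             (trans (∑-*ʳ (allFin c) _ _) (cong (_* _) (Enumeration.multiplicity-one (finEnumeration c) j)))) ⟩
      ∑ (allVecs n c) (λ v → 1 * 𝟙 (does (v ≟ᵥ a)))
        ≡⟨ ∑-cong (allVecs n c) (λ v → +-identityʳ _) ⟩
      ∑ (allVecs n c) (λ v → 𝟙 (does (v ≟ᵥ a)))
        ≡⟨ once n a ⟩
      1 ∎

module Colourings where
  open import Data.Nat using (_+_; _*_; _∸_; _≤ᵇ_; _≤?_)
  open import Data.Nat.Properties
    using (+-identityʳ; +-assoc; m≤m+n; ≤-trans; ≤-reflexive; ≤-antisym; 1+n≰n; m+n∸m≡n; m+[n∸m]≡n; 0∸n≡0; n∸n≡0; m∸n≡0⇒m≤n)
  open ≡ hiding ([_])
  open ≡-Reasoning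
  open Counting

  -- Adjacency need not be symmetric or irreflexive, so deletions, contractions and
  -- relabellings stay inside Graph.  The primed definitions below copy those of Defs,
  -- so that X G is definitionally the series of graph (adj G) (w G).
  record Graph (n : ℕ) : Set where
    constructor graph
    field
      adj : Fin n → Fin n → Bool
      wt  : Fin n → ℕ
  open Graph public

  PositiveWeights : ∀ {m} → Graph m → Set
  PositiveWeights H = ∀ x → 1 ≤ wt H x

  module _ {n : ℕ} (H : Graph n) {c : ℕ} where

    isProper′ : Vec (Fin c) n → Bool
    isProper′ κ = and (map (λ u → and (map (λ v →
        if adj H u v then not (does (Vec.lookup κ u ≟ Vec.lookup κ v)) else true)
      (allFin n))) (allFin n))

    colourWeight′ : Vec (Fin c) n → Fin c → ℕ
    colourWeight′ κ i = ∑ (allFin n) (λ v → if does (Vec.lookup κ v ≟ i) then wt H v else 0)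

    Proper : Vec (Fin c) n → Set
    Proper κ = ∀ u v → adj H u v ≡ true → Vec.lookup κ u ≢ Vec.lookup κ v

  hasMonomial′ : ∀ {n} (H : Graph n) (α : List ℕ) → Vec (Fin (length α)) n → Bool
  hasMonomial′ H α κ = and (map (λ i → lookup α i ≡ᵇ colourWeight′ H κ i) (allFin (length α)))

  countColourings′ : ∀ {n} → Graph n → List ℕ → ℕ
  countColourings′ {n} H α =
    length (filterᵇ (λ κ → isProper′ H κ ∧ hasMonomial′ H α κ) (allVecs n (length α)))

  module _ {n c : ℕ} (H : Graph n) (κ : Vec (Fin c) n) where

    isProper′⇒Proper : isProper′ H κ ≡ true → Proper H κ
    isProper′⇒Proper proper u v uv κu≡κv
      with () ← trans (sym (cong₂ (λ a d → if a then not d else true) uv (dec-true (Vec.lookup κ u ≟ Vec.lookup κ v) κu≡κv)))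
                      (and-allFin⁻ n _ (and-allFin⁻ n _ proper u) v)

    Proper⇒isProper′ : Proper H κ → isProper′ H κ ≡ true
    Proper⇒isProper′ proper = and-allFin⁺ n _ (λ u → and-allFin⁺ n _ (at u))
      where
      at : ∀ u v → (if adj H u v then not (does (Vec.lookup κ u ≟ Vec.lookup κ v)) else true) ≡ true
      at u v with adj H u v in uv
      ... | false = refl
      ... | true with Vec.lookup κ u ≟ Vec.lookup κ v
      ...   | yes κu≡κv = contradiction κu≡κv (proper u v uv)
      ...   | no _      = refl

  isProper′-cong : ∀ {n n′ c c′} (H : Graph n) (κ : Vec (Fin c) n) (H′ : Graph n′) (κ′ : Vec (Fin c′) n′) →
    (Proper H κ → Proper H′ κ′) → (Proper H′ κ′ → Proper H κ) → isProper′ H κ ≡ isProper′ H′ κ′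
  isProper′-cong H κ H′ κ′ to from = Bool-ext
    (λ p → Proper⇒isProper′ H′ κ′ (to (isProper′⇒Proper H κ p)))
    (λ p → Proper⇒isProper′ H κ (from (isProper′⇒Proper H′ κ′ p)))

  _≟ₗ_ : DecidableEquality (List ℕ)
  _≟ₗ_ = Listₚ.≡-dec ℕ._≟_

  exponents : ∀ {n} → Graph n → ∀ c → Vec (Fin c) n → List ℕ
  exponents H c κ = map (colourWeight′ H κ) (allFin c)

  admissible : ∀ {n} → Graph n → ∀ c → List ℕ → Vec (Fin c) n → Bool
  admissible H c α κ = isProper′ H κ ∧ does (α ≟ₗ exponents H c κ)

  count : ∀ {n} → Graph n → ℕ → List ℕ → ℕ
  count {n} H c α = ∑ (allVecs n c) (𝟙 ∘ admissible H c α)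

  and-lookup≡ᵇ : ∀ α (f : Fin (length α) → ℕ) →
    and (map (λ i → lookup α i ≡ᵇ f i) (allFin (length α))) ≡ does (α ≟ₗ map f (allFin (length α)))
  and-lookup≡ᵇ []      f = refl
  and-lookup≡ᵇ (a ∷ α) f = begin
    and (map (λ i → lookup (a ∷ α) i ≡ᵇ f i) (allFin (suc (length α))))
      ≡⟨ and-allFin-suc (length α) _ ⟩
    (a ≡ᵇ f zero) ∧ and (map (λ i → lookup α i ≡ᵇ f (suc i)) (allFin (length α)))
      ≡⟨ cong ((a ≡ᵇ f zero) ∧_) (and-lookup≡ᵇ α (f ∘ suc)) ⟩
    does ((a ∷ α) ≟ₗ (f zero ∷ map (f ∘ suc) (allFin (length α))))
      ≡⟨ cong (λ fs → does ((a ∷ α) ≟ₗ fs)) (sym (map-allFin-suc (length α) f)) ⟩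
    does ((a ∷ α) ≟ₗ map f (allFin (suc (length α)))) ∎

  countColourings′≡count : ∀ {n} (H : Graph n) α c → length α ≡ c → countColourings′ H α ≡ count H c α
  countColourings′≡count {n} H α _ refl = trans (length-filterᵇ _ (allVecs n (length α)))
    (∑-cong (allVecs n (length α)) (λ κ → cong (λ b → 𝟙 (isProper′ H κ ∧ b)) (and-lookup≡ᵇ α (colourWeight′ H κ))))

  infix 4 _≈ᴳ_
  _≈ᴳ_ : ∀ {n} → Graph n → Graph n → Set
  H ≈ᴳ H′ = (∀ a b → adj H a b ≡ adj H′ a b) × (∀ a → wt H a ≡ wt H′ a)

  count-cong : ∀ {n} {H H′ : Graph n} → H ≈ᴳ H′ → ∀ c α → count H c α ≡ count H′ c α
  count-cong {n} {H} {H′} (same-adj , same-wt) c α = ∑-cong (allVecs n c) (λ κ → cong 𝟙 (cong₂ _∧_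
    (isProper′-cong H κ H′ κ (λ p u v uv → p u v (trans (same-adj u v) uv))
                             (λ p u v uv → p u v (trans (sym (same-adj u v)) uv)))
    (cong (λ fs → does (α ≟ₗ fs)) (Listₚ.map-cong (λ i → ∑-cong (allFin n) (λ v →
      cong (if does (Vec.lookup κ v ≟ i) then_else 0) (same-wt v))) (allFin c)))))

  countColourings′-cong : ∀ {n} {H H′ : Graph n} → H ≈ᴳ H′ → ∀ α → countColourings′ H α ≡ countColourings′ H′ α
  countColourings′-cong {H = H} {H′} H≈H′ α = trans (countColourings′≡count H α _ refl)
    (trans (count-cong H≈H′ (length α) α) (sym (countColourings′≡count H′ α _ refl)))

  entry : ∀ {c} → List ℕ → Fin c → ℕ
  entry []      _       = 0
  entry (a ∷ α) zero    = a
  entry (a ∷ α) (suc i) = entry α i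

  adjustEntry : ∀ {c} → List ℕ → Fin c → (ℕ → ℕ) → List ℕ
  adjustEntry []      _       f = []
  adjustEntry (a ∷ α) zero    f = f a ∷ α
  adjustEntry (a ∷ α) (suc i) f = a ∷ adjustEntry α i f

  entry-map-allFin : ∀ c (g : Fin c → ℕ) i → entry (map g (allFin c)) i ≡ g i
  entry-map-allFin (suc c) g i rewrite map-allFin-suc c g with i
  ... | zero   = refl
  ... | suc i′ = entry-map-allFin c (g ∘ suc) i′

  entry-adjustEntry : ∀ {c} α (i : Fin c) f → f 0 ≡ 0 → entry (adjustEntry α i f) i ≡ f (entry α i)
  entry-adjustEntry []      i       f f0≡0 = sym f0≡0
  entry-adjustEntry (a ∷ α) zero    f f0≡0 = refl
  entry-adjustEntry (a ∷ α) (suc i) f f0≡0 = entry-adjustEntry α i f f0≡0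

  adjustEntry-cong : ∀ {c} α (i : Fin c) {f g} → f (entry α i) ≡ g (entry α i) → adjustEntry α i f ≡ adjustEntry α i g
  adjustEntry-cong []      i       eq = refl
  adjustEntry-cong (a ∷ α) zero    eq = cong (_∷ α) eq
  adjustEntry-cong (a ∷ α) (suc i) eq = cong (a ∷_) (adjustEntry-cong α i eq)

  length-adjustEntry : ∀ {c} α (i : Fin c) f → length (adjustEntry α i f) ≡ length α
  length-adjustEntry []      i       f = refl
  length-adjustEntry (a ∷ α) zero    f = refl
  length-adjustEntry (a ∷ α) (suc i) f = cong suc (length-adjustEntry α i f)

  ≡+⇔≤×∸≡ : ∀ a k g → (a ≡ k + g) ⇔ (k ≤ a × a ∸ k ≡ g)
  ≡+⇔≤×∸≡ a k g = mk⇔ (λ { refl → m≤m+n k g , m+n∸m≡n k g })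
                       (λ (k≤a , a∸k≡g) → trans (sym (m+[n∸m]≡n k≤a)) (cong (k +_) a∸k≡g))

  ≟-add-at : ∀ c α (i : Fin c) k (g : Fin c → ℕ) →
    does (α ≟ₗ map (λ j → (if does (i ≟ j) then k else 0) + g j) (allFin c))
      ≡ (k ≤ᵇ entry α i) ∧ does (adjustEntry α i (_∸ k) ≟ₗ map g (allFin c))
  ≟-add-at (suc c) α i k g
    rewrite map-allFin-suc c (λ j → (if does (i ≟ j) then k else 0) + g j) | map-allFin-suc c g = at α i
    where
    at : ∀ α (i : Fin (suc c)) →
      does (α ≟ₗ ((if does (i ≟ zero) then k else 0) + g zero
                   ∷ map (λ j → (if does (i ≟ suc j) then k else 0) + g (suc j)) (allFin c)))
        ≡ (k ≤ᵇ entry α i) ∧ does (adjustEntry α i (_∸ k) ≟ₗ (g zero ∷ map (g ∘ suc) (allFin c)))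
    at []      i       = sym (∧-zeroʳ _)
    at (a ∷ α) zero    = trans (cong (_∧ _) (does-⇔ (≡+⇔≤×∸≡ a k (g zero)) (a ℕ.≟ k + g zero) ((k ≤? a) ×-dec (a ∸ k ℕ.≟ g zero))))
                               (∧-assoc (k ≤ᵇ a) _ _)
    at (a ∷ α) (suc i) = trans (cong ((a ≡ᵇ g zero) ∧_) (≟-add-at c α i k (g ∘ suc)))
                               (∧-swap (a ≡ᵇ g zero) (k ≤ᵇ entry α i) _)

  delete₀ : ∀ {m} → Graph (suc m) → Graph m
  delete₀ H = graph (λ a b → adj H (suc a) (suc b)) (wt H ∘ suc)

  colourWeight′-cons : ∀ {m c} (H : Graph (suc m)) (i : Fin c) v j →
    colourWeight′ H (i ∷ v) j ≡ (if does (i ≟ j) then wt H zero else 0) + colourWeight′ (delete₀ H) v j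
  colourWeight′-cons {m} H i v j = ∑-allFin-suc m _

  Unused : ∀ {m c} → Vec (Fin c) m → Fin c → Set
  Unused v i = ∀ x → Vec.lookup v x ≢ i

  colourWeight′-unused : ∀ {m c} (H : Graph m) (v : Vec (Fin c) m) i → Unused v i → colourWeight′ H v i ≡ 0
  colourWeight′-unused {m} H v i unused = ∑-zero (allFin m) at
    where
    at : ∀ x → (if does (Vec.lookup v x ≟ i) then wt H x else 0) ≡ 0
    at x with Vec.lookup v x ≟ i
    ... | yes vx≡i = contradiction vx≡i (unused x)
    ... | no _     = refl

  colourWeight′-zero⇒unused : ∀ {m c} (H : Graph m) (v : Vec (Fin c) m) i → PositiveWeights H →
    colourWeight′ H v i ≡ 0 → Unused v i
  colourWeight′-zero⇒unused {m} H v i positive zero-weight x vx≡i =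
    1+n≰n (≤-trans (positive x) (subst (_≤ 0) (cong (if_then wt H x else 0) (dec-true (Vec.lookup v x ≟ i) vx≡i))
                                       (subst (weightAt x ≤_) zero-weight (∑-allFin-≥ m weightAt x))))
    where
    weightAt : Fin m → ℕ
    weightAt y = if does (Vec.lookup v y ≟ i) then wt H y else 0

  count-expand₀ : ∀ {m} (H : Graph (suc m)) c α →
    count H c α ≡ ∑ (allFin c) (λ i → ∑ (allVecs m c) (λ v → 𝟙 (admissible H c α (i ∷ v))))
  count-expand₀ {m} H c α = trans (∑-allVecs-suc m c _) (∑-swap (allVecs m c) (allFin c) _)

  Isolated₀ : ∀ {m} → Graph (suc m) → Set
  Isolated₀ H = ∀ x → adj H zero x ≡ false × adj H x zero ≡ false

  isProper′-isolated : ∀ {m c} (H : Graph (suc m)) → Isolated₀ H → ∀ (i : Fin c) v →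
    isProper′ H (i ∷ v) ≡ isProper′ (delete₀ H) v
  isProper′-isolated H isolated i v = isProper′-cong H (i ∷ v) (delete₀ H) v (λ p a b → p (suc a) (suc b)) extend
    where
    extend : Proper (delete₀ H) v → Proper H (i ∷ v)
    extend p zero    b       e = contradiction (trans (sym e) (proj₁ (isolated b))) λ ()
    extend p (suc a) zero    e = contradiction (trans (sym e) (proj₂ (isolated (suc a)))) λ ()
    extend p (suc a) (suc b) e = p a b e

  ≟-exponents-cons : ∀ {m c} (H : Graph (suc m)) α (i : Fin c) v →
    does (α ≟ₗ exponents H c (i ∷ v))
      ≡ (wt H zero ≤ᵇ entry α i) ∧ does (adjustEntry α i (_∸ wt H zero) ≟ₗ exponents (delete₀ H) c v)
  ≟-exponents-cons {c = c} H α i v =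
    trans (cong (λ fs → does (α ≟ₗ fs)) (Listₚ.map-cong (colourWeight′-cons H i v) (allFin c)))
          (≟-add-at c α i (wt H zero) (colourWeight′ (delete₀ H) v))

  count-isolated : ∀ {m} (H : Graph (suc m)) → Isolated₀ H → ∀ c α →
    count H c α ≡ ∑ (allFin c) (λ i → 𝟙 (wt H zero ≤ᵇ entry α i) * count (delete₀ H) c (adjustEntry α i (_∸ wt H zero)))
  count-isolated {m} H isolated c α = trans (count-expand₀ H c α) (∑-cong (allFin c) λ i →
    trans (∑-cong (allVecs m c) (factor i))
          (∑-*ˡ (allVecs m c) (𝟙 (wt H zero ≤ᵇ entry α i)) (𝟙 ∘ admissible (delete₀ H) c (adjustEntry α i (_∸ wt H zero)))))
    where
    factor : ∀ i v → 𝟙 (admissible H c α (i ∷ v))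
                   ≡ 𝟙 (wt H zero ≤ᵇ entry α i) * 𝟙 (admissible (delete₀ H) c (adjustEntry α i (_∸ wt H zero)) v)
    factor i v = trans (cong 𝟙 (trans (cong₂ _∧_ (isProper′-isolated H isolated i v) (≟-exponents-cons H α i v))
                                      (∧-swap (isProper′ (delete₀ H) v) (wt H zero ≤ᵇ entry α i) _)))
                       (𝟙-∧ (wt H zero ≤ᵇ entry α i) _)

  Dominating₀ : ∀ {m} → Graph (suc m) → Set
  Dominating₀ H = adj H zero zero ≡ false × (∀ x → adj H zero (suc x) ≡ true)

  module _ {m c : ℕ} (H : Graph (suc m)) (i : Fin c) (v : Vec (Fin c) m) where

    Proper-cons⁻ : Dominating₀ H → Proper H (i ∷ v) → Proper (delete₀ H) v × Unused v i
    Proper-cons⁻ (_ , dominating) proper = (λ a b → proper (suc a) (suc b)) , (λ x vx≡i → proper zero (suc x) (dominating x) (sym vx≡i))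

    Proper-cons⁺ : adj H zero zero ≡ false → Proper (delete₀ H) v → Unused v i → Proper H (i ∷ v)
    Proper-cons⁺ no-loop proper unused zero    zero    e = contradiction (trans (sym e) no-loop) λ ()
    Proper-cons⁺ no-loop proper unused zero    (suc b) e = unused b ∘ sym
    Proper-cons⁺ no-loop proper unused (suc a) zero    e = unused a
    Proper-cons⁺ no-loop proper unused (suc a) (suc b) e = proper a b e

    -- the colour of vertex 0 is used by no other vertex, so its exponent is exactly wt H zero
    ≟-exponents-unused : Unused v i → ∀ α →
      does (α ≟ₗ exponents H c (i ∷ v))
        ≡ (entry α i ≡ᵇ wt H zero) ∧ does (adjustEntry α i (λ _ → 0) ≟ₗ exponents (delete₀ H) c v)
    ≟-exponents-unused unused α = trans (≟-exponents-cons H α i v) (Bool-ext to from)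
      where
      w₀ = wt H zero
      rest = colourWeight′ (delete₀ H) v
      to : ((w₀ ≤ᵇ entry α i) ∧ does (adjustEntry α i (_∸ w₀) ≟ₗ exponents (delete₀ H) c v)) ≡ true →
           ((entry α i ≡ᵇ w₀) ∧ does (adjustEntry α i (λ _ → 0) ≟ₗ exponents (delete₀ H) c v)) ≡ true
      to matches with ∧-true⁻ {w₀ ≤ᵇ entry α i} matches
      ... | fits , others = cong₂ _∧_ (dec-true (entry α i ℕ.≟ w₀) αᵢ≡w₀)
                                      (dec-true (_ ≟ₗ _) (trans (adjustEntry-cong α i (sym αᵢ∸w₀≡0)) α∸≡rest))
        where
        α∸≡rest : adjustEntry α i (_∸ w₀) ≡ exponents (delete₀ H) c v
        α∸≡rest = witness (_ ≟ₗ _) others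
        αᵢ∸w₀≡0 : entry α i ∸ w₀ ≡ 0
        αᵢ∸w₀≡0 = trans (sym (entry-adjustEntry α i (_∸ w₀) (0∸n≡0 w₀)))
                   (trans (cong (λ β → entry β i) α∸≡rest)
                   (trans (entry-map-allFin c rest i) (colourWeight′-unused (delete₀ H) v i unused)))
        αᵢ≡w₀ : entry α i ≡ w₀
        αᵢ≡w₀ = ≤-antisym (m∸n≡0⇒m≤n αᵢ∸w₀≡0) (witness (w₀ ≤? entry α i) fits)
      from : ((entry α i ≡ᵇ w₀) ∧ does (adjustEntry α i (λ _ → 0) ≟ₗ exponents (delete₀ H) c v)) ≡ true →
             ((w₀ ≤ᵇ entry α i) ∧ does (adjustEntry α i (_∸ w₀) ≟ₗ exponents (delete₀ H) c v)) ≡ true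
      from matches with ∧-true⁻ {entry α i ≡ᵇ w₀} matches
      ... | exact , others = cong₂ _∧_ (dec-true (w₀ ≤? entry α i) (≤-reflexive (sym αᵢ≡w₀)))
                                       (dec-true (_ ≟ₗ _) (trans (adjustEntry-cong α i αᵢ∸w₀≡0) (witness (_ ≟ₗ _) others)))
        where
        αᵢ≡w₀ : entry α i ≡ w₀
        αᵢ≡w₀ = witness (entry α i ℕ.≟ w₀) exact
        αᵢ∸w₀≡0 : entry α i ∸ w₀ ≡ 0
        αᵢ∸w₀≡0 = trans (cong (_∸ w₀) αᵢ≡w₀) (n∸n≡0 w₀)

    admissible-dominating : Dominating₀ H → PositiveWeights H → ∀ α →
      admissible H c α (i ∷ v) ≡ (entry α i ≡ᵇ wt H zero) ∧ admissible (delete₀ H) c (adjustEntry α i (λ _ → 0)) v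
    admissible-dominating dominating positive α = Bool-ext to from
      where
      to : admissible H c α (i ∷ v) ≡ true →
           ((entry α i ≡ᵇ wt H zero) ∧ admissible (delete₀ H) c (adjustEntry α i (λ _ → 0)) v) ≡ true
      to ok with ∧-true⁻ {isProper′ H (i ∷ v)} ok
      ... | proper , matches with Proper-cons⁻ dominating (isProper′⇒Proper H (i ∷ v) proper)
      ...   | proper₀ , unused with ∧-true⁻ {entry α i ≡ᵇ wt H zero} (trans (sym (≟-exponents-unused unused α)) matches)
      ...     | exact , others = cong₂ _∧_ exact (cong₂ _∧_ (Proper⇒isProper′ (delete₀ H) v proper₀) others)
      from : ((entry α i ≡ᵇ wt H zero) ∧ admissible (delete₀ H) c (adjustEntry α i (λ _ → 0)) v) ≡ true →
             admissible H c α (i ∷ v) ≡ true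
      from ok with ∧-true⁻ {entry α i ≡ᵇ wt H zero} ok
      ... | exact , ok₀ with ∧-true⁻ {isProper′ (delete₀ H) v} ok₀
      ...   | proper₀ , others = cong₂ _∧_
                (Proper⇒isProper′ H (i ∷ v) (Proper-cons⁺ (proj₁ dominating) (isProper′⇒Proper (delete₀ H) v proper₀) unused))
                (trans (≟-exponents-unused unused α) (cong₂ _∧_ exact others))
        where
        restᵢ≡0 : colourWeight′ (delete₀ H) v i ≡ 0
        restᵢ≡0 = trans (sym (entry-map-allFin c (colourWeight′ (delete₀ H) v) i))
                  (trans (cong (λ β → entry β i) (sym (witness (adjustEntry α i (λ _ → 0) ≟ₗ exponents (delete₀ H) c v) others))) (entry-adjustEntry α i (λ _ → 0) refl))
        unused : Unused v i
        unused = colourWeight′-zero⇒unused (delete₀ H) v i (positive ∘ suc) restᵢ≡0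

  count-dominating : ∀ {m} (H : Graph (suc m)) → Dominating₀ H → PositiveWeights H → ∀ c α →
    count H c α ≡ ∑ (allFin c) (λ i → 𝟙 (entry α i ≡ᵇ wt H zero) * count (delete₀ H) c (adjustEntry α i (λ _ → 0)))
  count-dominating {m} H dominating positive c α = trans (count-expand₀ H c α) (∑-cong (allFin c) λ i →
    trans (∑-cong (allVecs m c) (λ v → trans (cong 𝟙 (admissible-dominating H i v dominating positive α))
                                             (𝟙-∧ (entry α i ≡ᵇ wt H zero) _)))
          (∑-*ˡ (allVecs m c) (𝟙 (entry α i ≡ᵇ wt H zero)) (𝟙 ∘ admissible (delete₀ H) c (adjustEntry α i (λ _ → 0)))))

  cutEdge : ∀ {m} → Graph (suc (suc m)) → Graph (suc (suc m))
  cutEdge {m} H = graph cut (wt H)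
    where
    cut : Fin (suc (suc m)) → Fin (suc (suc m)) → Bool
    cut (suc a)       (suc b)       = adj H (suc a) (suc b)
    cut zero          zero          = adj H zero zero
    cut zero          (suc zero)    = false
    cut zero          (suc (suc b)) = adj H zero (suc (suc b))
    cut (suc zero)    zero          = false
    cut (suc (suc a)) zero          = adj H (suc (suc a)) zero

  contract : ∀ {m} → (Bool → Bool → Bool) → Graph (suc (suc m)) → Graph (suc m)
  contract {m} op H = graph merged weight
    where
    merged : Fin (suc m) → Fin (suc m) → Bool
    merged zero    zero    = op (adj H zero zero) (adj H (suc zero) (suc zero))
    merged zero    (suc b) = op (adj H zero (suc (suc b))) (adj H (suc zero) (suc (suc b)))
    merged (suc a) zero    = op (adj H (suc (suc a)) zero) (adj H (suc (suc a)) (suc zero))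
    merged (suc a) (suc b) = adj H (suc (suc a)) (suc (suc b))
    weight : Fin (suc m) → ℕ
    weight zero    = wt H zero + wt H (suc zero)
    weight (suc a) = wt H (suc (suc a))

  -- Proper colourings of H without the edge 01 are those of H together with those giving
  -- vertices 0 and 1 one colour, i.e. the proper colourings of the contraction.
  module DeletionContraction {m c : ℕ} (H : Graph (suc (suc m))) (edge : adj H zero (suc zero) ≡ true) where

    H/e : Graph (suc m)
    H/e = contract _∨_ H

    isProper′-cut-distinct : ∀ (i j : Fin c) r → i ≢ j → isProper′ (cutEdge H) (i ∷ j ∷ r) ≡ isProper′ H (i ∷ j ∷ r)
    isProper′-cut-distinct i j r i≢j = isProper′-cong (cutEdge H) (i ∷ j ∷ r) H (i ∷ j ∷ r) to from
      where
      to : Proper (cutEdge H) (i ∷ j ∷ r) → Proper H (i ∷ j ∷ r)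
      to p zero          zero          = p zero zero
      to p zero          (suc zero)    = λ _ → i≢j
      to p zero          (suc (suc b)) = p zero (suc (suc b))
      to p (suc zero)    zero          = λ _ → i≢j ∘ sym
      to p (suc (suc a)) zero          = p (suc (suc a)) zero
      to p (suc a)       (suc b)       = p (suc a) (suc b)
      from : Proper H (i ∷ j ∷ r) → Proper (cutEdge H) (i ∷ j ∷ r)
      from p zero          zero          = p zero zero
      from p zero          (suc zero)    = λ ()
      from p zero          (suc (suc b)) = p zero (suc (suc b))
      from p (suc zero)    zero          = λ ()
      from p (suc (suc a)) zero          = p (suc (suc a)) zero
      from p (suc a)       (suc b)       = p (suc a) (suc b)

    isProper′-same : ∀ (j : Fin c) r → isProper′ H (j ∷ j ∷ r) ≡ false
    isProper′-same j r with isProper′ H (j ∷ j ∷ r) in proper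
    ... | false = refl
    ... | true  = contradiction refl (isProper′⇒Proper H (j ∷ j ∷ r) proper zero (suc zero) edge)

    isProper′-cut-same : ∀ (j : Fin c) r → isProper′ (cutEdge H) (j ∷ j ∷ r) ≡ isProper′ H/e (j ∷ r)
    isProper′-cut-same j r = isProper′-cong (cutEdge H) (j ∷ j ∷ r) H/e (j ∷ r) to from
      where
      to : Proper (cutEdge H) (j ∷ j ∷ r) → Proper H/e (j ∷ r)
      to p zero zero e with ∨-true⁻ {adj H zero zero} e
      ... | inj₁ e₀ = p zero zero e₀
      ... | inj₂ e₁ = p (suc zero) (suc zero) e₁
      to p zero (suc b) e with ∨-true⁻ {adj H zero (suc (suc b))} e
      ... | inj₁ e₀ = p zero (suc (suc b)) e₀
      ... | inj₂ e₁ = p (suc zero) (suc (suc b)) e₁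
      to p (suc a) zero e with ∨-true⁻ {adj H (suc (suc a)) zero} e
      ... | inj₁ e₀ = p (suc (suc a)) zero e₀
      ... | inj₂ e₁ = p (suc (suc a)) (suc zero) e₁
      to p (suc a) (suc b) e = p (suc (suc a)) (suc (suc b)) e
      from : Proper H/e (j ∷ r) → Proper (cutEdge H) (j ∷ j ∷ r)
      from p zero          zero          e = p zero zero (cong (_∨ adj H (suc zero) (suc zero)) e)
      from p zero          (suc zero)    ()
      from p zero          (suc (suc b)) e = p zero (suc b) (cong (_∨ adj H (suc zero) (suc (suc b))) e)
      from p (suc zero)    zero          ()
      from p (suc zero)    (suc zero)    e = p zero zero (∨-trueʳ (adj H zero zero) e)
      from p (suc zero)    (suc (suc b)) e = p zero (suc b) (∨-trueʳ (adj H zero (suc (suc b))) e)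
      from p (suc (suc a)) zero          e = p (suc a) zero (cong (_∨ adj H (suc (suc a)) (suc zero)) e)
      from p (suc (suc a)) (suc zero)    e = p (suc a) zero (∨-trueʳ (adj H (suc (suc a)) zero) e)
      from p (suc (suc a)) (suc (suc b)) e = p (suc a) (suc b) e

    colourWeight′-contract : ∀ (j : Fin c) r l → colourWeight′ (cutEdge H) (j ∷ j ∷ r) l ≡ colourWeight′ H/e (j ∷ r) l
    colourWeight′-contract j r l = begin
      colourWeight′ (cutEdge H) (j ∷ j ∷ r) l
        ≡⟨ colourWeight′-cons (cutEdge H) j (j ∷ r) l ⟩
      (if does (j ≟ l) then wt H zero else 0) + colourWeight′ (delete₀ (cutEdge H)) (j ∷ r) l
        ≡⟨ cong ((if does (j ≟ l) then wt H zero else 0) +_) (colourWeight′-cons (delete₀ (cutEdge H)) j r l) ⟩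
      (if does (j ≟ l) then wt H zero else 0) + ((if does (j ≟ l) then wt H (suc zero) else 0) + rest)
        ≡⟨ merge (does (j ≟ l)) ⟩
      (if does (j ≟ l) then wt H zero + wt H (suc zero) else 0) + rest
        ≡⟨ colourWeight′-cons H/e j r l ⟨
      colourWeight′ H/e (j ∷ r) l ∎
      where
      rest = colourWeight′ (delete₀ (delete₀ H)) r l
      merge : ∀ b → (if b then wt H zero else 0) + ((if b then wt H (suc zero) else 0) + rest)
                  ≡ (if b then wt H zero + wt H (suc zero) else 0) + rest
      merge true  = sym (+-assoc (wt H zero) _ rest)
      merge false = refl

    admissible-cut : ∀ α (i j : Fin c) r →
      𝟙 (admissible (cutEdge H) c α (i ∷ j ∷ r)) ≡ 𝟙 (admissible H c α (i ∷ j ∷ r)) + 𝟙 (does (i ≟ j)) * 𝟙 (admissible H/e c α (j ∷ r))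
    admissible-cut α i j r = by-cases (i ≟ j) refl
      where
      by-cases : (i≟j : Dec (i ≡ j)) → does i≟j ≡ does (i ≟ j) →
        𝟙 (admissible (cutEdge H) c α (i ∷ j ∷ r)) ≡ 𝟙 (admissible H c α (i ∷ j ∷ r)) + 𝟙 (does (i ≟ j)) * 𝟙 (admissible H/e c α (j ∷ r))
      by-cases (yes refl) same = begin
        𝟙 (admissible (cutEdge H) c α (i ∷ i ∷ r))
          ≡⟨ cong 𝟙 (cong₂ _∧_ (isProper′-cut-same i r)
                               (cong (λ fs → does (α ≟ₗ fs)) (Listₚ.map-cong (colourWeight′-contract i r) (allFin c)))) ⟩
        𝟙 (admissible H/e c α (i ∷ r))
          ≡⟨ +-identityʳ _ ⟨
        𝟙 (false ∧ does (α ≟ₗ exponents H c (i ∷ i ∷ r))) + 1 * 𝟙 (admissible H/e c α (i ∷ r))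
          ≡⟨ cong₂ (λ b d → 𝟙 (b ∧ does (α ≟ₗ exponents H c (i ∷ i ∷ r))) + 𝟙 d * 𝟙 (admissible H/e c α (i ∷ r)))
                   (isProper′-same i r) (sym same) ⟨
        𝟙 (admissible H c α (i ∷ i ∷ r)) + 𝟙 (does (i ≟ i)) * 𝟙 (admissible H/e c α (i ∷ r)) ∎
      by-cases (no i≢j) distinct = begin
        𝟙 (admissible (cutEdge H) c α (i ∷ j ∷ r))
          ≡⟨ cong 𝟙 (cong (_∧ does (α ≟ₗ exponents H c (i ∷ j ∷ r))) (isProper′-cut-distinct i j r i≢j)) ⟩
        𝟙 (admissible H c α (i ∷ j ∷ r))
          ≡⟨ +-identityʳ _ ⟨
        𝟙 (admissible H c α (i ∷ j ∷ r)) + 𝟙 false * 𝟙 (admissible H/e c α (j ∷ r))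
          ≡⟨ cong (λ d → 𝟙 (admissible H c α (i ∷ j ∷ r)) + 𝟙 d * 𝟙 (admissible H/e c α (j ∷ r))) distinct ⟩
        𝟙 (admissible H c α (i ∷ j ∷ r)) + 𝟙 (does (i ≟ j)) * 𝟙 (admissible H/e c α (j ∷ r)) ∎

    count-deletion-contraction : ∀ α → count (cutEdge H) c α ≡ count H c α + count H/e c α
    count-deletion-contraction α = begin
      count (cutEdge H) c α
        ≡⟨ expand (cutEdge H) ⟩
      ∑ rs (λ r → ∑ cs (λ j → ∑ cs (λ i → 𝟙 (admissible (cutEdge H) c α (i ∷ j ∷ r)))))
        ≡⟨ ∑-cong rs (λ r → ∑-cong cs (λ j → split j r)) ⟩
      ∑ rs (λ r → ∑ cs (λ j → ∑ cs (λ i → 𝟙 (admissible H c α (i ∷ j ∷ r))) + 𝟙 (admissible H/e c α (j ∷ r))))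
        ≡⟨ ∑-cong rs (λ r → ∑-+ cs _ _) ⟩
      ∑ rs (λ r → ∑ cs (λ j → ∑ cs (λ i → 𝟙 (admissible H c α (i ∷ j ∷ r)))) + ∑ cs (λ j → 𝟙 (admissible H/e c α (j ∷ r))))
        ≡⟨ ∑-+ rs _ _ ⟩
      ∑ rs (λ r → ∑ cs (λ j → ∑ cs (λ i → 𝟙 (admissible H c α (i ∷ j ∷ r)))))
        + ∑ rs (λ r → ∑ cs (λ j → 𝟙 (admissible H/e c α (j ∷ r))))
        ≡⟨ cong₂ _+_ (expand H) (∑-allVecs-suc m c _) ⟨
      count H c α + count H/e c α ∎
      where
      rs = allVecs m c
      cs = allFin c
      expand : ∀ H′ → count H′ c α ≡ ∑ rs (λ r → ∑ cs (λ j → ∑ cs (λ i → 𝟙 (admissible H′ c α (i ∷ j ∷ r)))))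
      expand H′ = trans (∑-allVecs-suc (suc m) c _) (∑-allVecs-suc m c _)
      split : ∀ j r → ∑ cs (λ i → 𝟙 (admissible (cutEdge H) c α (i ∷ j ∷ r)))
                    ≡ ∑ cs (λ i → 𝟙 (admissible H c α (i ∷ j ∷ r))) + 𝟙 (admissible H/e c α (j ∷ r))
      split j r = trans (∑-cong cs (λ i → admissible-cut α i j r))
        (trans (∑-+ cs _ _) (cong (∑ cs (λ i → 𝟙 (admissible H c α (i ∷ j ∷ r))) +_) (∑-select (finEnumeration c) j (λ _ → 𝟙 (admissible H/e c α (j ∷ r))))))

  relabel : ∀ {n} → (Fin n → Fin n) → Graph n → Graph n
  relabel π H = graph (λ a b → adj H (π a) (π b)) (wt H ∘ π)

  precompose : ∀ {n c} → (Fin n → Fin n) → Vec (Fin c) n → Vec (Fin c) n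
  precompose π κ = Vec.tabulate (Vec.lookup κ ∘ π)

  module _ {n : ℕ} (π : Fin n ↔ Fin n) where
    open Inverse π

    precompose-↔ : ∀ c → Vec (Fin c) n ↔ Vec (Fin c) n
    precompose-↔ c = mk↔ₛ′ (precompose from) (precompose to) (cancel strictlyInverseˡ) (cancel strictlyInverseʳ)
      where
      cancel : ∀ {f g : Fin n → Fin n} → (∀ a → f (g a) ≡ a) → ∀ κ → precompose g (precompose f κ) ≡ κ
      cancel {f} {g} f∘g≡id κ = trans (Vecₚ.tabulate-cong (λ y → trans (Vecₚ.lookup∘tabulate (Vec.lookup κ ∘ f) (g y)) (cong (Vec.lookup κ) (f∘g≡id y))))
                              (Vecₚ.tabulate∘lookup κ)

    admissible-relabel : ∀ (H : Graph n) c α κ → admissible (relabel to H) c α κ ≡ admissible H c α (precompose from κ)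
    admissible-relabel H c α κ = cong₂ _∧_ proper (cong (λ fs → does (α ≟ₗ fs)) (Listₚ.map-cong weight (allFin c)))
      where
      κ′ = precompose from κ
      lookup-κ′ : ∀ y → Vec.lookup κ′ y ≡ Vec.lookup κ (from y)
      lookup-κ′ y = Vecₚ.lookup∘tabulate _ y
      proper : isProper′ (relabel to H) κ ≡ isProper′ H κ′
      proper = isProper′-cong (relabel to H) κ H κ′
        (λ p y z e κ′y≡κ′z → p (from y) (from z)
          (subst₂ (λ a b → adj H a b ≡ true) (sym (strictlyInverseˡ y)) (sym (strictlyInverseˡ z)) e)
          (trans (sym (lookup-κ′ y)) (trans κ′y≡κ′z (lookup-κ′ z))))
        (λ p a b e κa≡κb → p (to a) (to b) e
          (trans (lookup-κ′ (to a)) (trans (cong (Vec.lookup κ) (strictlyInverseʳ a))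
          (trans κa≡κb (sym (trans (lookup-κ′ (to b)) (cong (Vec.lookup κ) (strictlyInverseʳ b))))))))
      weight : ∀ l → colourWeight′ (relabel to H) κ l ≡ colourWeight′ H κ′ l
      weight l = begin
        ∑ (allFin n) (λ x → if does (Vec.lookup κ x ≟ l) then wt H (to x) else 0)
          ≡⟨ ∑-cong (allFin n) (λ x → cong (λ y → if does (Vec.lookup κ y ≟ l) then wt H (to x) else 0) (sym (strictlyInverseʳ x))) ⟩
        ∑ (allFin n) (λ x → if does (Vec.lookup κ (from (to x)) ≟ l) then wt H (to x) else 0)
          ≡⟨ ∑-reindex (finEnumeration n) (finEnumeration n) π (λ y → if does (Vec.lookup κ (from y) ≟ l) then wt H y else 0) ⟩
        ∑ (allFin n) (λ y → if does (Vec.lookup κ (from y) ≟ l) then wt H y else 0)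
          ≡⟨ ∑-cong (allFin n) (λ y → cong (λ k → if does (k ≟ l) then wt H y else 0) (sym (lookup-κ′ y))) ⟩
        ∑ (allFin n) (λ y → if does (Vec.lookup κ′ y ≟ l) then wt H y else 0) ∎

    count-relabel : ∀ (H : Graph n) c α → count (relabel to H) c α ≡ count H c α
    count-relabel H c α = trans (∑-cong (allVecs n c) (λ κ → cong 𝟙 (admissible-relabel H c α κ)))
      (∑-reindex (vecEnumeration n c) (vecEnumeration n c) (precompose-↔ c) (𝟙 ∘ admissible H c α))

  swapAdjacent : ℕ → List ℕ → List ℕ
  swapAdjacent zero    (a ∷ b ∷ l) = b ∷ a ∷ l
  swapAdjacent zero    l           = l
  swapAdjacent (suc p) []          = []
  swapAdjacent (suc p) (a ∷ l)     = a ∷ swapAdjacent p l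

  swapAdjacent-involutive : ∀ p l → swapAdjacent p (swapAdjacent p l) ≡ l
  swapAdjacent-involutive zero    []          = refl
  swapAdjacent-involutive zero    (a ∷ [])    = refl
  swapAdjacent-involutive zero    (a ∷ b ∷ l) = refl
  swapAdjacent-involutive (suc p) []          = refl
  swapAdjacent-involutive (suc p) (a ∷ l)     = cong (a ∷_) (swapAdjacent-involutive p l)

  swapColours : ∀ {c} → ℕ → Fin c → Fin c
  swapColours {suc c}       (suc p) zero          = zero
  swapColours {suc c}       (suc p) (suc i)       = suc (swapColours p i)
  swapColours {suc zero}    zero    i             = i
  swapColours {suc (suc c)} zero    zero          = suc zero
  swapColours {suc (suc c)} zero    (suc zero)    = zero
  swapColours {suc (suc c)} zero    (suc (suc i)) = suc (suc i)

  swapColours-involutive : ∀ {c} p (i : Fin c) → swapColours p (swapColours p i) ≡ i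
  swapColours-involutive {suc c}       (suc p) zero          = refl
  swapColours-involutive {suc c}       (suc p) (suc i)       = cong suc (swapColours-involutive p i)
  swapColours-involutive {suc zero}    zero    zero          = refl
  swapColours-involutive {suc (suc c)} zero    zero          = refl
  swapColours-involutive {suc (suc c)} zero    (suc zero)    = refl
  swapColours-involutive {suc (suc c)} zero    (suc (suc i)) = refl

  map-swapColours : ∀ c p (f : Fin c → ℕ) → map (f ∘ swapColours p) (allFin c) ≡ swapAdjacent p (map f (allFin c))
  map-swapColours zero          zero    f = refl
  map-swapColours zero          (suc p) f = refl
  map-swapColours (suc zero)    zero    f = refl
  map-swapColours (suc (suc c)) zero    f = begin
    map (f ∘ swapColours zero) (allFin (suc (suc c)))
      ≡⟨ trans (map-allFin-suc (suc c) _) (cong (f (suc zero) ∷_) (map-allFin-suc c _)) ⟩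
    f (suc zero) ∷ f zero ∷ map (λ i → f (suc (suc i))) (allFin c)
      ≡⟨ cong (swapAdjacent zero) (trans (map-allFin-suc (suc c) f) (cong (f zero ∷_) (map-allFin-suc c (f ∘ suc)))) ⟨
    swapAdjacent zero (map f (allFin (suc (suc c)))) ∎
  map-swapColours (suc c)       (suc p) f = begin
    map (f ∘ swapColours (suc p)) (allFin (suc c))
      ≡⟨ map-allFin-suc c _ ⟩
    f zero ∷ map (λ i → f (suc (swapColours p i))) (allFin c)
      ≡⟨ cong (f zero ∷_) (map-swapColours c p (f ∘ suc)) ⟩
    f zero ∷ swapAdjacent p (map (f ∘ suc) (allFin c))
      ≡⟨ cong (swapAdjacent (suc p)) (map-allFin-suc c f) ⟨
    swapAdjacent (suc p) (map f (allFin (suc c))) ∎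

  module _ {n c : ℕ} (H : Graph n) (p : ℕ) where

    swapColours-↔ : Vec (Fin c) n ↔ Vec (Fin c) n
    swapColours-↔ = mk↔ₛ′ (Vec.map (swapColours p)) (Vec.map (swapColours p)) involutive involutive
      where
      involutive : ∀ κ → Vec.map (swapColours p) (Vec.map (swapColours p) κ) ≡ κ
      involutive κ = trans (sym (Vecₚ.map-∘ _ _ κ)) (trans (Vecₚ.map-cong (swapColours-involutive p) κ) (Vecₚ.map-id κ))

    admissible-swapColours : ∀ α κ → admissible H c α (Vec.map (swapColours p) κ) ≡ admissible H c (swapAdjacent p α) κ
    admissible-swapColours α κ = cong₂ _∧_ proper (begin
      does (α ≟ₗ exponents H c (Vec.map (swapColours p) κ))
        ≡⟨ cong (λ fs → does (α ≟ₗ fs)) (trans (Listₚ.map-cong weight (allFin c)) (map-swapColours c p (colourWeight′ H κ))) ⟩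
      does (α ≟ₗ swapAdjacent p (exponents H c κ))
        ≡⟨ does-⇔ (mk⇔ (λ α≡ → trans (cong (swapAdjacent p) α≡) (swapAdjacent-involutive p _))
                       (λ ≡β → trans (sym (swapAdjacent-involutive p α)) (cong (swapAdjacent p) ≡β)))
                  (α ≟ₗ _) (swapAdjacent p α ≟ₗ _) ⟩
      does (swapAdjacent p α ≟ₗ exponents H c κ) ∎)
      where
      σ = swapColours {c} p
      lookup-map : ∀ x → Vec.lookup (Vec.map σ κ) x ≡ σ (Vec.lookup κ x)
      lookup-map x = Vecₚ.lookup-map x σ κ
      σ-injective : ∀ {a b} → σ a ≡ σ b → a ≡ b
      σ-injective {a} {b} eq = trans (sym (swapColours-involutive p a)) (trans (cong σ eq) (swapColours-involutive p b))
      proper : isProper′ H (Vec.map σ κ) ≡ isProper′ H κ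
      proper = isProper′-cong H (Vec.map σ κ) H κ
        (λ q a b e κa≡κb → q a b e (trans (lookup-map a) (trans (cong σ κa≡κb) (sym (lookup-map b)))))
        (λ q a b e sκa≡sκb → q a b e (σ-injective (trans (sym (lookup-map a)) (trans sκa≡sκb (lookup-map b)))))
      weight : ∀ l → colourWeight′ H (Vec.map σ κ) l ≡ colourWeight′ H κ (σ l)
      weight l = ∑-cong (allFin n) (λ x → cong (if_then wt H x else 0) (trans (cong (λ k → does (k ≟ l)) (lookup-map x))
        (does-⇔ (mk⇔ (λ e → trans (sym (swapColours-involutive p _)) (cong σ e))
                     (λ e → trans (cong σ e) (swapColours-involutive p l)))
                (σ (Vec.lookup κ x) ≟ l) (Vec.lookup κ x ≟ σ l))))

    count-swapAdjacent : ∀ α → count H c (swapAdjacent p α) ≡ count H c α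
    count-swapAdjacent α = trans (∑-cong (allVecs n c) (λ κ → cong 𝟙 (sym (admissible-swapColours α κ))))
      (∑-reindex (vecEnumeration n c) (vecEnumeration n c) swapColours-↔ (𝟙 ∘ admissible H c α))

  swapAdjacent-++ : ∀ (π : List ℕ) x y l → swapAdjacent (length π) (π ++ x ∷ y ∷ l) ≡ π ++ y ∷ x ∷ l
  swapAdjacent-++ []      x y l = refl
  swapAdjacent-++ (a ∷ π) x y l = cong (a ∷_) (swapAdjacent-++ π x y l)

  count-↭-suffix : ∀ {n} (H : Graph n) c (π : List ℕ) {α β : List ℕ} → α ↭ β → count H c (π ++ α) ≡ count H c (π ++ β)
  count-↭-suffix H c π ↭-refl = refl
  count-↭-suffix H c π (prep {xs} {ys} x α↭β) = begin
    count H c (π ++ x ∷ xs)     ≡⟨ cong (count H c) (Listₚ.++-assoc π [ x ] xs) ⟨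
    count H c ((π ++ [ x ]) ++ xs) ≡⟨ count-↭-suffix H c (π ++ [ x ]) α↭β ⟩
    count H c ((π ++ [ x ]) ++ ys) ≡⟨ cong (count H c) (Listₚ.++-assoc π [ x ] ys) ⟩
    count H c (π ++ x ∷ ys)     ∎
  count-↭-suffix H c π (swap {xs} {ys} x y α↭β) = begin
    count H c (π ++ x ∷ y ∷ xs)
      ≡⟨ count-swapAdjacent H (length π) (π ++ x ∷ y ∷ xs) ⟨
    count H c (swapAdjacent (length π) (π ++ x ∷ y ∷ xs))
      ≡⟨ cong (count H c) (trans (swapAdjacent-++ π x y xs) (sym (Listₚ.++-assoc π (y ∷ x ∷ []) xs))) ⟩
    count H c ((π ++ y ∷ x ∷ []) ++ xs)
      ≡⟨ count-↭-suffix H c (π ++ y ∷ x ∷ []) α↭β ⟩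
    count H c ((π ++ y ∷ x ∷ []) ++ ys)
      ≡⟨ cong (count H c) (Listₚ.++-assoc π (y ∷ x ∷ []) ys) ⟩
    count H c (π ++ y ∷ x ∷ ys) ∎
  count-↭-suffix H c π (↭-trans α↭β β↭γ) = trans (count-↭-suffix H c π α↭β) (count-↭-suffix H c π β↭γ)

  count-↭ : ∀ {n} (H : Graph n) c {α β : List ℕ} → α ↭ β → count H c α ≡ count H c β
  count-↭ H c = count-↭-suffix H c []

  ∑-allVecs-avoiding-zero : ∀ n c (f : Vec (Fin (suc c)) n → ℕ) → (∀ κ x → Vec.lookup κ x ≡ zero → f κ ≡ 0) →
    ∑ (allVecs n (suc c)) f ≡ ∑ (allVecs n c) (f ∘ Vec.map suc)
  ∑-allVecs-avoiding-zero zero    c f vanish = refl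
  ∑-allVecs-avoiding-zero (suc n) c f vanish = begin
    ∑ (allVecs (suc n) (suc c)) f
      ≡⟨ ∑-allVecs-suc n (suc c) f ⟩
    ∑ (allVecs n (suc c)) (λ v → ∑ (allFin (suc c)) (λ i → f (i ∷ v)))
      ≡⟨ ∑-cong (allVecs n (suc c)) (λ v → trans (∑-allFin-suc c (λ i → f (i ∷ v))) (cong (_+ ∑ (allFin c) (λ j → f (suc j ∷ v))) (vanish (zero ∷ v) zero refl))) ⟩
    ∑ (allVecs n (suc c)) (λ v → ∑ (allFin c) (λ j → f (suc j ∷ v)))
      ≡⟨ ∑-allVecs-avoiding-zero n c _ (λ κ x κx≡0 → ∑-zero (allFin c) (λ j → vanish (suc j ∷ κ) (suc x) κx≡0)) ⟩
    ∑ (allVecs n c) (λ v → ∑ (allFin c) (λ j → f (suc j ∷ Vec.map suc v)))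
      ≡⟨ ∑-allVecs-suc n c (λ κ → f (Vec.map suc κ)) ⟨
    ∑ (allVecs (suc n) c) (f ∘ Vec.map suc) ∎

  count-pad : ∀ {n} (H : Graph n) → PositiveWeights H → ∀ c α → count H (suc c) (0 ∷ α) ≡ count H c α
  count-pad {n} H positive c α = trans (∑-allVecs-avoiding-zero n c (𝟙 ∘ admissible H (suc c) (0 ∷ α)) vanish)
    (∑-cong (allVecs n c) (λ κ → cong 𝟙 (cong₂ _∧_ (proper κ) (cong (λ fs → does ((0 ∷ α) ≟ₗ fs)) (shifted κ)))))
    where
    vanish : ∀ κ x → Vec.lookup κ x ≡ zero → 𝟙 (admissible H (suc c) (0 ∷ α) κ) ≡ 0
    vanish κ x κx≡0 = cong 𝟙 (trans (cong (isProper′ H κ ∧_) (dec-false ((0 ∷ α) ≟ₗ exponents H (suc c) κ) mismatch))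
                                   (∧-zeroʳ (isProper′ H κ)))
      where
      mismatch : 0 ∷ α ≢ exponents H (suc c) κ
      mismatch α≡exps = colourWeight′-zero⇒unused H κ zero positive
        (sym (Listₚ.∷-injectiveˡ (trans α≡exps (map-allFin-suc c _)))) x κx≡0
    lookup-suc : ∀ (κ : Vec (Fin c) n) x → Vec.lookup (Vec.map suc κ) x ≡ suc (Vec.lookup κ x)
    lookup-suc κ x = Vecₚ.lookup-map x suc κ
    proper : ∀ κ → isProper′ H (Vec.map suc κ) ≡ isProper′ H κ
    proper κ = isProper′-cong H (Vec.map suc κ) H κ
      (λ q a b e κa≡κb → q a b e (trans (lookup-suc κ a) (trans (cong suc κa≡κb) (sym (lookup-suc κ b)))))
      (λ q a b e sκa≡sκb → q a b e (Finₚ.suc-injective (trans (sym (lookup-suc κ a)) (trans sκa≡sκb (lookup-suc κ b)))))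
    shifted : ∀ κ → exponents H (suc c) (Vec.map suc κ) ≡ 0 ∷ exponents H c κ
    shifted κ = trans (map-allFin-suc c _) (cong₂ _∷_
      (colourWeight′-unused H (Vec.map suc κ) zero (λ x e → contradiction (trans (sym (lookup-suc κ x)) e) λ ()))
      (Listₚ.map-cong (λ l → ∑-cong (allFin n) (λ x → cong (λ k → if does (k ≟ suc l) then wt H x else 0) (lookup-suc κ x))) (allFin c)))

  ∑-colourWeight′ : ∀ {n c} (H : Graph n) (κ : Vec (Fin c) n) → ∑ (allFin c) (colourWeight′ H κ) ≡ ∑ (allFin n) (wt H)
  ∑-colourWeight′ {n} {c} H κ = trans (∑-swap (allFin c) (allFin n) _) (∑-cong (allFin n) once)
    where
    once : ∀ x → ∑ (allFin c) (λ l → if does (Vec.lookup κ x ≟ l) then wt H x else 0) ≡ wt H x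
    once x = trans (∑-cong (allFin c) (λ l → trans (as-product (does (Vec.lookup κ x ≟ l)))
                     (cong (λ b → 𝟙 b * wt H x) (does-⇔ (mk⇔ sym sym) (Vec.lookup κ x ≟ l) (l ≟ Vec.lookup κ x)))))
                   (∑-select (finEnumeration c) (Vec.lookup κ x) (λ _ → wt H x))
      where
      as-product : ∀ b → (if b then wt H x else 0) ≡ 𝟙 b * wt H x
      as-product true  = sym (+-identityʳ _)
      as-product false = refl

  count-weight-mismatch : ∀ {n} (H : Graph n) c α → sum α ≢ ∑ (allFin n) (wt H) → count H c α ≡ 0
  count-weight-mismatch {n} H c α mismatch = ∑-zero (allVecs n c) vanish
    where
    vanish : ∀ κ → 𝟙 (admissible H c α κ) ≡ 0
    vanish κ = cong 𝟙 (trans (cong (isProper′ H κ ∧_) (dec-false (α ≟ₗ exponents H c κ)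
                                 (λ α≡exps → mismatch (trans (cong sum α≡exps) (∑-colourWeight′ H κ)))))
                             (∧-zeroʳ (isProper′ H κ)))

  countColourings′-↭ : ∀ {n} (H : Graph n) {α β} → α ↭ β → countColourings′ H α ≡ countColourings′ H β
  countColourings′-↭ H {α} {β} α↭β = begin
    countColourings′ H α   ≡⟨ countColourings′≡count H α _ refl ⟩
    count H (length α) α   ≡⟨ count-↭ H (length α) α↭β ⟩
    count H (length α) β   ≡⟨ countColourings′≡count H β _ (sym (↭-length α↭β)) ⟨
    countColourings′ H β   ∎

  countColourings′-pad : ∀ {n} (H : Graph n) → PositiveWeights H → ∀ α → countColourings′ H (α ++ [ 0 ]) ≡ countColourings′ H α
  countColourings′-pad H positive α = begin
    countColourings′ H (α ++ [ 0 ])       ≡⟨ countColourings′-↭ H (++-comm α [ 0 ]) ⟩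
    countColourings′ H (0 ∷ α)            ≡⟨ countColourings′≡count H (0 ∷ α) _ refl ⟩
    count H (suc (length α)) (0 ∷ α)      ≡⟨ count-pad H positive (length α) α ⟩
    count H (length α) α                  ≡⟨ countColourings′≡count H α _ refl ⟨
    countColourings′ H α                  ∎

module Series {c ℓ : Level} (F : Field c ℓ) where
  open import Data.Nat using (_<_; _∸_; _≤ᵇ_)
  open Field F hiding (zero)
  open SymFun F
  open Counting using (∑; 𝟙; length-filterᵇ; witness)
  open Colourings
  open import Relation.Binary.Reasoning.Setoid setoid
  module 𝕂 = ListSum commutativeSemiring

  ≈ˢ-refl : ∀ {f} → f ≈ˢ f
  ≈ˢ-refl α = refl

  ≈ˢ-sym : ∀ {f g} → f ≈ˢ g → g ≈ˢ f
  ≈ˢ-sym f≈g α = sym (f≈g α)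

  ≈ˢ-trans : ∀ {f g h} → f ≈ˢ g → g ≈ˢ h → f ≈ˢ h
  ≈ˢ-trans f≈g g≈h α = trans (f≈g α) (g≈h α)

  Seriesₛ : Setoid c ℓ
  Seriesₛ = record { Carrier = Series ; _≈_ = _≈ˢ_
                   ; isEquivalence = record { refl = ≈ˢ-refl ; sym = ≈ˢ-sym ; trans = ≈ˢ-trans } }

  +ˢ-cong : ∀ {f f′ g g′} → f ≈ˢ f′ → g ≈ˢ g′ → (f +ˢ g) ≈ˢ (f′ +ˢ g′)
  +ˢ-cong f≈f′ g≈g′ α = +-cong (f≈f′ α) (g≈g′ α)

  •-cong : ∀ {a b f g} → a ≈ b → f ≈ˢ g → (a • f) ≈ˢ (b • g)
  •-cong a≈b f≈g α = *-cong a≈b (f≈g α)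

  ⊙-cong : ∀ {f f′ g g′} → f ≈ˢ f′ → g ≈ˢ g′ → (f ⊙ g) ≈ˢ (f′ ⊙ g′)
  ⊙-cong f≈f′ g≈g′ α = 𝕂.∑-cong (subseqSplits (nonzeroParts α)) (λ (β , γ) → *-cong (f≈f′ β) (g≈g′ γ))

  •-⊙ : ∀ a f g → ((a • f) ⊙ g) ≈ˢ (a • (f ⊙ g))
  •-⊙ a f g α = trans (𝕂.∑-cong (subseqSplits (nonzeroParts α)) (λ (β , γ) → *-assoc a (f β) (g γ)))
                      (𝕂.∑-*ˡ (subseqSplits (nonzeroParts α)) a (λ (β , γ) → f β * g γ))

  fromℕ-+ : ∀ a b → fromℕ (a ℕ.+ b) ≈ fromℕ a + fromℕ b
  fromℕ-+ zero    b = sym (+-identityˡ _)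
  fromℕ-+ (suc a) b = trans (+-congˡ (fromℕ-+ a b)) (sym (+-assoc _ _ _))

  fromℕ-∑ : ∀ {A : Set} (xs : List A) (f : A → ℕ) → fromℕ (∑ xs f) ≈ 𝕂.∑ xs (fromℕ ∘ f)
  fromℕ-∑ []       f = refl
  fromℕ-∑ (x ∷ xs) f = trans (fromℕ-+ (f x) _) (+-congˡ (fromℕ-∑ xs f))

  fromℕ-𝟙* : ∀ b n → fromℕ (𝟙 b ℕ.* n) ≈ (if b then fromℕ n else 0#)
  fromℕ-𝟙* true  n = reflexive (≡.cong fromℕ (ℕₚ.+-identityʳ n))
  fromℕ-𝟙* false n = refl

  if-cong : ∀ (b : Bool) {x y : Carrier} → x ≈ y → (if b then x else 0#) ≈ (if b then y else 0#)
  if-cong true  x≈y = x≈y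
  if-cong false x≈y = refl

  IsΛ-resp : ∀ {f g} → f ≈ˢ g → IsΛ f → IsΛ g
  IsΛ-resp f≈g f∈Λ = record
    { padding   = λ α → trans (sym (f≈g _)) (trans (IsΛ.padding f∈Λ α) (f≈g α))
    ; symmetric = λ α β α↭β → trans (sym (f≈g α)) (trans (IsΛ.symmetric f∈Λ α β α↭β) (f≈g β))
    ; bounded   = proj₁ (IsΛ.bounded f∈Λ) , λ α d<|α| → trans (sym (f≈g α)) (proj₂ (IsΛ.bounded f∈Λ) α d<|α|)
    }

  zeroParts : List ℕ → ℕ
  zeroParts []          = 0
  zeroParts (zero ∷ α)  = suc (zeroParts α)
  zeroParts (suc a ∷ α) = zeroParts α

  ↭-nonzeroParts : ∀ α → α ↭ nonzeroParts α ++ replicate (zeroParts α) 0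
  ↭-nonzeroParts []          = ↭-refl
  ↭-nonzeroParts (zero ∷ α)  = ↭-trans (prep 0 (↭-nonzeroParts α)) (↭-sym (shift 0 (nonzeroParts α) _))
  ↭-nonzeroParts (suc a ∷ α) = prep (suc a) (↭-nonzeroParts α)

  nonzeroParts-↭ : ∀ {α β} → α ↭ β → nonzeroParts α ↭ nonzeroParts β
  nonzeroParts-↭ = filter-↭ (λ a → T? (not (a ≡ᵇ 0)))

  nonzeroParts-++-0 : ∀ α → nonzeroParts (α ++ [ 0 ]) ≡ nonzeroParts α
  nonzeroParts-++-0 []          = ≡.refl
  nonzeroParts-++-0 (zero ∷ α)  = nonzeroParts-++-0 α
  nonzeroParts-++-0 (suc a ∷ α) = ≡.cong (suc a ∷_) (nonzeroParts-++-0 α)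

  sum-nonzeroParts : ∀ α → sum (nonzeroParts α) ≡ sum α
  sum-nonzeroParts []          = ≡.refl
  sum-nonzeroParts (zero ∷ α)  = sum-nonzeroParts α
  sum-nonzeroParts (suc a ∷ α) = ≡.cong (suc a ℕ.+_) (sum-nonzeroParts α)

  module _ {f : Series} (f∈Λ : IsΛ f) where

    IsΛ-pad : ∀ α z → f (α ++ replicate z 0) ≈ f α
    IsΛ-pad α zero    = reflexive (≡.cong f (Listₚ.++-identityʳ α))
    IsΛ-pad α (suc z) = trans (reflexive (≡.cong f (≡.sym (Listₚ.++-assoc α [ 0 ] (replicate z 0)))))
                              (trans (IsΛ-pad (α ++ [ 0 ]) z) (IsΛ.padding f∈Λ α))

    IsΛ-nonzeroParts : ∀ α → f α ≈ f (nonzeroParts α)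
    IsΛ-nonzeroParts α = trans (IsΛ.symmetric f∈Λ α _ (↭-nonzeroParts α)) (IsΛ-pad (nonzeroParts α) (zeroParts α))

  pₙ : ℕ → List ℕ → Carrier
  pₙ k []          = 0#
  pₙ k (a ∷ [])    = if a ≡ᵇ k then 1# else 0#
  pₙ k (a ∷ b ∷ l) = 0#

  pˢ≡pₙ : ∀ k α → pˢ k α ≡ pₙ k (nonzeroParts α)
  pˢ≡pₙ k α with nonzeroParts α
  ... | []        = ≡.refl
  ... | a ∷ []    = ≡.refl
  ... | a ∷ b ∷ l = ≡.refl

  pₙ-↭ : ∀ k {L L′} → L ↭ L′ → pₙ k L ≡ pₙ k L′
  pₙ-↭ k {[]}     L↭L′ rewrite ↭-empty-inv (↭-sym L↭L′) = ≡.refl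
  pₙ-↭ k {a ∷ []} L↭L′ rewrite ↭-singleton-inv (↭-sym L↭L′) = ≡.refl
  pₙ-↭ k {a ∷ b ∷ l} {L′} L↭L′ with L′ | ↭-length L↭L′
  ... | []         | ()
  ... | _ ∷ []     | ()
  ... | _ ∷ _ ∷ _  | _ = ≡.refl

  pₙ-bounded : ∀ k L → k < sum L → pₙ k L ≈ 0#
  pₙ-bounded k []          k<ΣL = refl
  pₙ-bounded k (a ∷ [])    k<ΣL with a ≡ᵇ k in a≡ᵇk
  ... | false = refl
  ... | true  = contradiction (≡.subst (k <_) (ℕₚ.+-identityʳ a) k<ΣL)
                              (ℕₚ.<-irrefl (≡.sym (witness (a ℕ.≟ k) a≡ᵇk)))
  pₙ-bounded k (a ∷ b ∷ l) k<ΣL = refl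

  IsΛ-p : ∀ k → IsΛ (pˢ k)
  IsΛ-p k = record
    { padding   = λ α → reflexive (≡.trans (pˢ≡pₙ k (α ++ [ 0 ]))
                                  (≡.trans (≡.cong (pₙ k) (nonzeroParts-++-0 α)) (≡.sym (pˢ≡pₙ k α))))
    ; symmetric = λ α β α↭β → reflexive (≡.trans (pˢ≡pₙ k α)
                                        (≡.trans (pₙ-↭ k (nonzeroParts-↭ α↭β)) (≡.sym (pˢ≡pₙ k β))))
    ; bounded   = k , λ α k<Σα → trans (reflexive (pˢ≡pₙ k α))
                                       (pₙ-bounded k (nonzeroParts α) (≡.subst (k <_) (≡.sym (sum-nonzeroParts α)) k<Σα))
    }

  isZeroMon≡null : ∀ β → isZeroMon β ≡ null (nonzeroParts β)
  isZeroMon≡null []          = ≡.refl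
  isZeroMon≡null (zero ∷ β)  = isZeroMon≡null β
  isZeroMon≡null (suc b ∷ β) = ≡.refl

  pˢ-suc-cons : ∀ k j β → pˢ k (suc j ∷ β) ≈ (if suc j ≡ᵇ k then 1ˢ β else 0#)
  pˢ-suc-cons k j β with nonzeroParts β | isZeroMon≡null β
  ... | []    | zero-mon = reflexive (≡.cong (λ b → if suc j ≡ᵇ k then (if b then 1# else 0#) else 0#) (≡.sym zero-mon))
  ... | _ ∷ _ | zero-mon with suc j ≡ᵇ k
  ...   | false = refl
  ...   | true  = reflexive (≡.cong (if_then 1# else 0#) (≡.sym zero-mon))

  ∑-splits-cons : ∀ a α (f : List ℕ × List ℕ → Carrier) →
    𝕂.∑ (splits (a ∷ α)) f ≈ 𝕂.∑ (upTo (suc a)) (λ i → 𝕂.∑ (splits α) (λ (β , γ) → f (i ∷ β , a ∸ i ∷ γ)))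
  ∑-splits-cons a α f = trans (𝕂.∑-concatMap (λ i → map (λ (β , γ) → i ∷ β , a ∸ i ∷ γ) (splits α)) (upTo (suc a)) f)
    (𝕂.∑-cong (upTo (suc a)) (λ i → reflexive (𝕂.∑-map (λ (β , γ) → i ∷ β , a ∸ i ∷ γ) (splits α) f)))

  ∑-subseqSplits-cons : ∀ b L (f : List ℕ × List ℕ → Carrier) →
    𝕂.∑ (subseqSplits (b ∷ L)) f ≈ 𝕂.∑ (subseqSplits L) (λ (β , γ) → f (b ∷ β , γ) + f (β , b ∷ γ))
  ∑-subseqSplits-cons b L f = trans (𝕂.∑-concatMap (λ (β , γ) → (b ∷ β , γ) ∷ (β , b ∷ γ) ∷ []) (subseqSplits L) f)
    (𝕂.∑-cong (subseqSplits L) (λ (β , γ) → +-congˡ (+-identityʳ _)))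

  ·ˢ-identityˡ : ∀ G → (1ˢ ·ˢ G) ≈ˢ G
  ·ˢ-identityˡ G []      = trans (+-identityʳ _) (*-identityˡ _)
  ·ˢ-identityˡ G (a ∷ α) = begin
    (1ˢ ·ˢ G) (a ∷ α)
      ≈⟨ ∑-splits-cons a α (λ (β , γ) → 1ˢ β * G γ) ⟩
    𝕂.∑ (upTo (suc a)) (λ i → 𝕂.∑ (splits α) (λ (β , γ) → 1ˢ (i ∷ β) * G (a ∸ i ∷ γ)))
      ≡⟨ 𝕂.∑-upTo-suc a _ ⟩
    (1ˢ ·ˢ (λ γ → G (a ∷ γ))) α + 𝕂.∑ (upTo a) (λ j → 𝕂.∑ (splits α) (λ (β , γ) → 0# * G (a ∸ suc j ∷ γ)))
      ≈⟨ +-cong (·ˢ-identityˡ (λ γ → G (a ∷ γ)) α)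
                (𝕂.∑-zero (upTo a) (λ j → 𝕂.∑-zero (splits α) (λ _ → zeroˡ _))) ⟩
    G (a ∷ α) + 0#
      ≈⟨ +-identityʳ _ ⟩
    G (a ∷ α) ∎

  1ˢ-⊙ : ∀ G α → (1ˢ ⊙ G) α ≈ G (nonzeroParts α)
  1ˢ-⊙ G []          = trans (+-identityʳ _) (*-identityˡ _)
  1ˢ-⊙ G (zero ∷ α)  = 1ˢ-⊙ G α
  1ˢ-⊙ G (suc a ∷ α) = begin
    (1ˢ ⊙ G) (suc a ∷ α)
      ≈⟨ ∑-subseqSplits-cons (suc a) (nonzeroParts α) (λ (β , γ) → 1ˢ β * G γ) ⟩
    𝕂.∑ (subseqSplits (nonzeroParts α)) (λ (β , γ) → 0# * G γ + 1ˢ β * G (suc a ∷ γ))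
      ≈⟨ 𝕂.∑-cong (subseqSplits (nonzeroParts α)) (λ _ → trans (+-congʳ (zeroˡ _)) (+-identityˡ _)) ⟩
    (1ˢ ⊙ (λ γ → G (suc a ∷ γ))) α
      ≈⟨ 1ˢ-⊙ (λ γ → G (suc a ∷ γ)) α ⟩
    G (suc a ∷ nonzeroParts α) ∎

  -- Multiplying by p_k removes k from one exponent; the ⊙-product instead uses up a whole part equal to k.
  pˢ-·ˢ : ∀ k (G : Series) α → 1 ≤ k →
    (pˢ k ·ˢ G) α ≈ 𝕂.∑ (allFin (length α)) (λ i → if k ≤ᵇ entry α i then G (adjustEntry α i (_∸ k)) else 0#)
  pˢ-·ˢ k       G []      1≤k = trans (+-identityʳ _) (zeroˡ _)
  pˢ-·ˢ (suc k) G (a ∷ α) 1≤k = begin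
    (pˢ (suc k) ·ˢ G) (a ∷ α)
      ≈⟨ ∑-splits-cons a α (λ (β , γ) → pˢ (suc k) β * G γ) ⟩
    𝕂.∑ (upTo (suc a)) (λ i → 𝕂.∑ (splits α) (λ (β , γ) → pˢ (suc k) (i ∷ β) * G (a ∸ i ∷ γ)))
      ≡⟨ 𝕂.∑-upTo-suc a _ ⟩
    (pˢ (suc k) ·ˢ (λ γ → G (a ∷ γ))) α + 𝕂.∑ (upTo a) (λ j → 𝕂.∑ (splits α) (λ (β , γ) → pˢ (suc k) (suc j ∷ β) * G (a ∸ suc j ∷ γ)))
      ≈⟨ +-cong (pˢ-·ˢ (suc k) (λ γ → G (a ∷ γ)) α 1≤k) (𝕂.∑-cong (upTo a) part-j) ⟩
    𝕂.∑ (allFin (length α)) (h ∘ suc) + 𝕂.∑ (upTo a) (λ j → if j ≡ᵇ k then G (a ∸ suc j ∷ α) else 0#)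
      ≈⟨ +-congˡ (𝕂.∑-upTo-select a k (λ j → G (a ∸ suc j ∷ α))) ⟩
    𝕂.∑ (allFin (length α)) (h ∘ suc) + h zero
      ≈⟨ +-comm _ _ ⟩
    h zero + 𝕂.∑ (allFin (length α)) (h ∘ suc)
      ≡⟨ 𝕂.∑-allFin-suc (length α) h ⟨
    𝕂.∑ (allFin (suc (length α))) h ∎
    where
    h : Fin (suc (length α)) → Carrier
    h i = if suc k ≤ᵇ entry (a ∷ α) i then G (adjustEntry (a ∷ α) i (_∸ suc k)) else 0#
    part-j : ∀ j → 𝕂.∑ (splits α) (λ (β , γ) → pˢ (suc k) (suc j ∷ β) * G (a ∸ suc j ∷ γ))
                   ≈ (if j ≡ᵇ k then G (a ∸ suc j ∷ α) else 0#)
    part-j j with j ≡ᵇ k in j≡ᵇk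
    ... | true  = trans (𝕂.∑-cong (splits α) (λ (β , γ) → *-congʳ (trans (pˢ-suc-cons (suc k) j β) (reflexive (≡.cong (if_then 1ˢ β else 0#) j≡ᵇk)))))
                        (·ˢ-identityˡ (λ γ → G (a ∸ suc j ∷ γ)) α)
    ... | false = 𝕂.∑-zero (splits α) (λ (β , γ) → trans (*-congʳ (trans (pˢ-suc-cons (suc k) j β) (reflexive (≡.cong (if_then 1ˢ β else 0#) j≡ᵇk))))
                                                         (zeroˡ _))

  pˢ-⊙ : ∀ k (G : Series) α → 1 ≤ k →
    (pˢ k ⊙ G) α ≈ 𝕂.∑ (allFin (length α)) (λ i → if entry α i ≡ᵇ k then G (nonzeroParts (adjustEntry α i (λ _ → 0))) else 0#)
  pˢ-⊙ k       G []          1≤k = trans (+-identityʳ _) (zeroˡ _)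
  pˢ-⊙ (suc k) G (zero ∷ α)  1≤k = trans (pˢ-⊙ (suc k) G α 1≤k) (trans (sym (+-identityˡ _)) (reflexive (≡.sym (𝕂.∑-allFin-suc (length α) _))))
  pˢ-⊙ (suc k) G (suc a ∷ α) 1≤k = begin
    (pˢ (suc k) ⊙ G) (suc a ∷ α)
      ≈⟨ ∑-subseqSplits-cons (suc a) (nonzeroParts α) (λ (β , γ) → pˢ (suc k) β * G γ) ⟩
    𝕂.∑ (subseqSplits (nonzeroParts α)) (λ (β , γ) → pˢ (suc k) (suc a ∷ β) * G γ + pˢ (suc k) β * G (suc a ∷ γ))
      ≈⟨ 𝕂.∑-+ (subseqSplits (nonzeroParts α)) _ _ ⟩
    𝕂.∑ (subseqSplits (nonzeroParts α)) (λ (β , γ) → pˢ (suc k) (suc a ∷ β) * G γ) + (pˢ (suc k) ⊙ (λ γ → G (suc a ∷ γ))) α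
      ≈⟨ +-cong head (pˢ-⊙ (suc k) (λ γ → G (suc a ∷ γ)) α 1≤k) ⟩
    h zero + 𝕂.∑ (allFin (length α)) (h ∘ suc)
      ≡⟨ 𝕂.∑-allFin-suc (length α) h ⟨
    𝕂.∑ (allFin (suc (length α))) h ∎
    where
    h : Fin (suc (length α)) → Carrier
    h i = if entry (suc a ∷ α) i ≡ᵇ suc k then G (nonzeroParts (adjustEntry (suc a ∷ α) i (λ _ → 0))) else 0#
    head : 𝕂.∑ (subseqSplits (nonzeroParts α)) (λ (β , γ) → pˢ (suc k) (suc a ∷ β) * G γ) ≈ h zero
    head with a ≡ᵇ k in a≡ᵇk
    ... | true  = trans (𝕂.∑-cong (subseqSplits (nonzeroParts α)) (λ (β , γ) → *-congʳ (trans (pˢ-suc-cons (suc k) a β) (reflexive (≡.cong (if_then 1ˢ β else 0#) a≡ᵇk)))))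
                        (1ˢ-⊙ G α)
    ... | false = 𝕂.∑-zero (subseqSplits (nonzeroParts α)) (λ (β , γ) → trans (*-congʳ (trans (pˢ-suc-cons (suc k) a β) (reflexive (≡.cong (if_then 1ˢ β else 0#) a≡ᵇk))))
                                                                          (zeroˡ _))

  Xᴳ : ∀ {n} → Graph n → Series
  Xᴳ H α = fromℕ (countColourings′ H α)

  Xᴳ≈count : ∀ {n} (H : Graph n) α → Xᴳ H α ≈ fromℕ (count H (length α) α)
  Xᴳ≈count H α = reflexive (≡.cong fromℕ (countColourings′≡count H α (length α) ≡.refl))

  Xᴳ-cong : ∀ {n} {H H′ : Graph n} → H ≈ᴳ H′ → Xᴳ H ≈ˢ Xᴳ H′
  Xᴳ-cong H≈H′ α = reflexive (≡.cong fromℕ (countColourings′-cong H≈H′ α))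

  IsΛ-Xᴳ : ∀ {n} (H : Graph n) → PositiveWeights H → IsΛ (Xᴳ H)
  IsΛ-Xᴳ {n} H positive = record
    { padding   = λ α → reflexive (≡.cong fromℕ (countColourings′-pad H positive α))
    ; symmetric = λ α β α↭β → reflexive (≡.cong fromℕ (countColourings′-↭ H α↭β))
    ; bounded   = ∑ (allFin n) (wt H) , λ α d<Σα → trans (Xᴳ≈count H α)
        (reflexive (≡.cong fromℕ (count-weight-mismatch H (length α) α (λ Σα≡d → ℕₚ.<-irrefl (≡.sym Σα≡d) d<Σα))))
    }

  Xᴳ-empty : ∀ (H : Graph 0) → Xᴳ H ≈ˢ 1ˢ
  Xᴳ-empty H α = trans (reflexive (≡.cong fromℕ (≡.trans (length-filterᵇ (λ κ → isProper′ H κ ∧ hasMonomial′ H α κ) (allVecs 0 (length α)))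
                                                          (≡.cong (λ b → 𝟙 b ℕ.+ 0) zero-monomial))))
                       (unit (isZeroMon α))
    where
    zero-monomial : and (map (λ i → lookup α i ≡ᵇ 0) (allFin (length α))) ≡ isZeroMon α
    zero-monomial = ≡.cong and (≡.trans (Listₚ.map-tabulate id _)
                      (≡.sym (≡.trans (≡.cong (map (_≡ᵇ 0)) (≡.sym (Listₚ.tabulate-lookup α))) (Listₚ.map-tabulate _ _))))
    unit : ∀ b → fromℕ (𝟙 b ℕ.+ 0) ≈ (if b then 1# else 0#)
    unit true  = +-identityʳ 1#
    unit false = refl

  Xᴳ-isolated : ∀ {m} (H : Graph (suc m)) → Isolated₀ H → PositiveWeights H → Xᴳ H ≈ˢ (pˢ (wt H zero) ·ˢ Xᴳ (delete₀ H))
  Xᴳ-isolated H isolated positive α = begin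
    Xᴳ H α
      ≈⟨ Xᴳ≈count H α ⟩
    fromℕ (count H L α)
      ≡⟨ ≡.cong fromℕ (count-isolated H isolated L α) ⟩
    fromℕ (∑ (allFin L) (λ i → 𝟙 (w₀ ≤ᵇ entry α i) ℕ.* count (delete₀ H) L (adjustEntry α i (_∸ w₀))))
      ≈⟨ fromℕ-∑ (allFin L) _ ⟩
    𝕂.∑ (allFin L) (λ i → fromℕ (𝟙 (w₀ ≤ᵇ entry α i) ℕ.* count (delete₀ H) L (adjustEntry α i (_∸ w₀))))
      ≈⟨ 𝕂.∑-cong (allFin L) (λ i → trans (fromℕ-𝟙* (w₀ ≤ᵇ entry α i) (count (delete₀ H) L (adjustEntry α i (_∸ w₀)))) (if-cong (w₀ ≤ᵇ entry α i)
           (sym (reflexive (≡.cong fromℕ (countColourings′≡count (delete₀ H) (adjustEntry α i (_∸ w₀)) L (length-adjustEntry α i _))))))) ⟩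
    𝕂.∑ (allFin L) (λ i → if w₀ ≤ᵇ entry α i then Xᴳ (delete₀ H) (adjustEntry α i (_∸ w₀)) else 0#)
      ≈⟨ pˢ-·ˢ w₀ (Xᴳ (delete₀ H)) α (positive zero) ⟨
    (pˢ w₀ ·ˢ Xᴳ (delete₀ H)) α ∎
    where
    L = length α
    w₀ = wt H zero

  Xᴳ-dominating : ∀ {m} (H : Graph (suc m)) → Dominating₀ H → PositiveWeights H → Xᴳ H ≈ˢ (pˢ (wt H zero) ⊙ Xᴳ (delete₀ H))
  Xᴳ-dominating H dominating positive α = begin
    Xᴳ H α
      ≈⟨ Xᴳ≈count H α ⟩
    fromℕ (count H L α)
      ≡⟨ ≡.cong fromℕ (count-dominating H dominating positive L α) ⟩
    fromℕ (∑ (allFin L) (λ i → 𝟙 (entry α i ≡ᵇ w₀) ℕ.* count (delete₀ H) L (adjustEntry α i (λ _ → 0))))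
      ≈⟨ fromℕ-∑ (allFin L) _ ⟩
    𝕂.∑ (allFin L) (λ i → fromℕ (𝟙 (entry α i ≡ᵇ w₀) ℕ.* count (delete₀ H) L (adjustEntry α i (λ _ → 0))))
      ≈⟨ 𝕂.∑-cong (allFin L) (λ i → trans (fromℕ-𝟙* (entry α i ≡ᵇ w₀) (count (delete₀ H) L (adjustEntry α i (λ _ → 0)))) (if-cong (entry α i ≡ᵇ w₀)
           (trans (sym (reflexive (≡.cong fromℕ (countColourings′≡count (delete₀ H) (adjustEntry α i (λ _ → 0)) L (length-adjustEntry α i _)))))
                  (IsΛ-nonzeroParts (IsΛ-Xᴳ (delete₀ H) (positive ∘ suc)) (adjustEntry α i (λ _ → 0)))))) ⟩
    𝕂.∑ (allFin L) (λ i → if entry α i ≡ᵇ w₀ then Xᴳ (delete₀ H) (nonzeroParts (adjustEntry α i (λ _ → 0))) else 0#)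
      ≈⟨ pˢ-⊙ w₀ (Xᴳ (delete₀ H)) α (positive zero) ⟨
    (pˢ w₀ ⊙ Xᴳ (delete₀ H)) α ∎
    where
    L = length α
    w₀ = wt H zero

  Xᴳ-deletion-contraction : ∀ {m} (H : Graph (suc (suc m))) → adj H zero (suc zero) ≡ true →
    Xᴳ (cutEdge H) ≈ˢ (Xᴳ H +ˢ Xᴳ (contract _∨_ H))
  Xᴳ-deletion-contraction H edge α = begin
    Xᴳ (cutEdge H) α
      ≈⟨ Xᴳ≈count (cutEdge H) α ⟩
    fromℕ (count (cutEdge H) (length α) α)
      ≡⟨ ≡.cong fromℕ (DeletionContraction.count-deletion-contraction H edge α) ⟩
    fromℕ (count H (length α) α ℕ.+ count (contract _∨_ H) (length α) α)
      ≈⟨ fromℕ-+ (count H (length α) α) (count (contract _∨_ H) (length α) α) ⟩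
    fromℕ (count H (length α) α) + fromℕ (count (contract _∨_ H) (length α) α)
      ≈⟨ +-cong (Xᴳ≈count H α) (Xᴳ≈count (contract _∨_ H) α) ⟨
    Xᴳ H α + Xᴳ (contract _∨_ H) α ∎

  Xᴳ-relabel : ∀ {n} (π : Fin n ↔ Fin n) (H : Graph n) → Xᴳ (relabel (Inverse.to π) H) ≈ˢ Xᴳ H
  Xᴳ-relabel π H α = trans (Xᴳ≈count (relabel (Inverse.to π) H) α)
    (trans (reflexive (≡.cong fromℕ (count-relabel π H (length α) α))) (sym (Xᴳ≈count H α)))

module Recurrence {c ℓ : Level} (F : Field c ℓ) where
  open Field F hiding (zero)
  open SymFun F
  open Counting using (∧-true⁻; ∨-true⁻)
  open Colourings
  open Series F
  open import Algebra.Properties.Ring ring using (-1*x≈-x)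
  open import Algebra.Properties.Group +-group using (⁻¹-involutive)
  open import Relation.Binary.Reasoning.Setoid setoid

  -- ψ k is the image of p_k.  Contracting an edge comes with the sign σ, and σ ε = 1
  -- makes a contracted edge whose weight lies in Es contribute with coefficient +1.
  record DeletionContractionInvariant (Vs Es Cs : ℕ → Set) : Set (c ⊔ ℓ) where
    field
      Ψ            : ∀ {m} → Graph m → Series
      merge        : Bool → Bool → Bool
      merge-false  : merge false false ≡ false
      merge-true⁻  : ∀ a b → merge a b ≡ true → a ≡ true ⊎ b ≡ true
      σ ε          : Carrier
      σε≈1         : σ * ε ≈ 1#
      ψ            : ℕ → Series
      ψ-V          : ∀ k → Vs k → ψ k ≈ˢ (1# • pˢ k)
      ψ-E          : ∀ k → Es k → ψ k ≈ˢ (ε • pˢ k)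
      ψ-C          : ∀ k → Cs k → ψ k ≈ˢ (0# • pˢ k)
      Ψ-empty      : ∀ (H : Graph 0) → Ψ H ≈ˢ 1ˢ
      Ψ-cong       : ∀ {m} {H H′ : Graph m} → PositiveWeights H → H ≈ᴳ H′ → Ψ H ≈ˢ Ψ H′
      Ψ-relabel    : ∀ {m} (π : Fin m ↔ Fin m) (H : Graph m) → PositiveWeights H → Ψ (relabel (Inverse.to π) H) ≈ˢ Ψ H
      Ψ-cut        : ∀ {m} (H : Graph (suc (suc m))) → PositiveWeights H →
                     adj H zero (suc zero) ≡ true → adj H (suc zero) zero ≡ true →
                     Ψ H ≈ˢ (Ψ (cutEdge H) +ˢ (σ • Ψ (contract merge H)))
      Ψ-isolated   : ∀ {m} (H : Graph (suc m)) → PositiveWeights H → Isolated₀ H →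
                     ∀ a → ψ (wt H zero) ≈ˢ (a • pˢ (wt H zero)) → Ψ H ≈ˢ (a • (pˢ (wt H zero) ⊙ Ψ (delete₀ H)))

  IsΛ-1ˢ : IsΛ 1ˢ
  IsΛ-1ˢ = IsΛ-resp (Xᴳ-empty E) (IsΛ-Xᴳ E (λ ()))
    where
    E : Graph 0
    E = graph (λ ()) (λ ())

  PositiveWeights-relabel : ∀ {m} (π : Fin m → Fin m) (H : Graph m) → PositiveWeights H → PositiveWeights (relabel π H)
  PositiveWeights-relabel π H positive = positive ∘ π

  PositiveWeights-contract : ∀ {m} op (H : Graph (suc (suc m))) → PositiveWeights H → PositiveWeights (contract op H)
  PositiveWeights-contract op H positive zero    = ℕₚ.≤-trans (positive zero) (ℕₚ.m≤m+n _ _)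
  PositiveWeights-contract op H positive (suc a) = positive (suc (suc a))

  PositiveWeights-cong : ∀ {m} {H H′ : Graph m} → H ≈ᴳ H′ → PositiveWeights H → PositiveWeights H′
  PositiveWeights-cong (_ , same-wt) positive a = ≡.subst (1 ≤_) (same-wt a) (positive a)

  module _ (Vs Es Cs : ℕ → Set) (φ : Series → Series) (φ-hom : IsHomΛΛ̃ φ)
           (φ-V : ∀ k → Vs k → φ (pˢ k) ≈ˢ pˢ k) (φ-E : ∀ k → Es k → φ (pˢ k) ≈ˢ (-ˢ pˢ k))
           (φ-C : ∀ k → Cs k → φ (pˢ k) ≈ˢ 0ˢ) where
    open IsHomΛΛ̃ φ-hom

    φ∘X-cut : ∀ {m} (H : Graph (suc (suc m))) → PositiveWeights H → adj H zero (suc zero) ≡ true →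
      φ (Xᴳ H) ≈ˢ (φ (Xᴳ (cutEdge H)) +ˢ ((- 1#) • φ (Xᴳ (contract _∨_ H))))
    φ∘X-cut H positive edge α = sym (begin
      cut + (- 1#) * con      ≈⟨ +-cong (split α) (-1*x≈-x con) ⟩
      (whole + con) + (- con) ≈⟨ +-assoc whole con (- con) ⟩
      whole + (con + (- con)) ≈⟨ +-congˡ (-‿inverseʳ con) ⟩
      whole + 0#              ≈⟨ +-identityʳ whole ⟩
      whole                   ∎)
      where
      cut∈Λ = IsΛ-Xᴳ (cutEdge H) positive
      split : φ (Xᴳ (cutEdge H)) ≈ˢ (φ (Xᴳ H) +ˢ φ (Xᴳ (contract _∨_ H)))
      split = ≈ˢ-trans (resp _ _ cut∈Λ (IsΛ-resp (Xᴳ-deletion-contraction H edge) cut∈Λ) (Xᴳ-deletion-contraction H edge))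
                       (additive _ _ (IsΛ-Xᴳ H positive) (IsΛ-Xᴳ (contract _∨_ H) (PositiveWeights-contract _∨_ H positive)))
      cut   = φ (Xᴳ (cutEdge H)) α
      whole = φ (Xᴳ H) α
      con   = φ (Xᴳ (contract _∨_ H)) α

    φ∘X-isolated : ∀ {m} (H : Graph (suc m)) → PositiveWeights H → Isolated₀ H →
      ∀ a → φ (pˢ (wt H zero)) ≈ˢ (a • pˢ (wt H zero)) → φ (Xᴳ H) ≈ˢ (a • (pˢ (wt H zero) ⊙ φ (Xᴳ (delete₀ H))))
    φ∘X-isolated H positive isolated a φp≈ap =
      ≈ˢ-trans (resp _ _ (IsΛ-Xᴳ H positive) (IsΛ-resp factor (IsΛ-Xᴳ H positive)) factor)
      (≈ˢ-trans (multiplicative _ _ (IsΛ-p (wt H zero)) (IsΛ-Xᴳ (delete₀ H) (positive ∘ suc)))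
      (≈ˢ-trans (⊙-cong φp≈ap ≈ˢ-refl) (•-⊙ a (pˢ (wt H zero)) _)))
      where
      factor = Xᴳ-isolated H isolated positive

    φ∘X-invariant : DeletionContractionInvariant Vs Es Cs
    φ∘X-invariant = record
      { Ψ           = λ H → φ (Xᴳ H)
      ; merge       = _∨_
      ; merge-false = ≡.refl
      ; merge-true⁻ = λ a b → ∨-true⁻
      ; σ           = - 1#
      ; ε           = - 1#
      ; σε≈1        = trans (-1*x≈-x (- 1#)) (⁻¹-involutive 1#)
      ; ψ           = λ k → φ (pˢ k)
      ; ψ-V         = λ k k∈V α → trans (φ-V k k∈V α) (sym (*-identityˡ _))
      ; ψ-E         = λ k k∈E α → trans (φ-E k k∈E α) (sym (-1*x≈-x _))
      ; ψ-C         = λ k k∈C α → trans (φ-C k k∈C α) (sym (zeroˡ _))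
      ; Ψ-empty     = λ H → ≈ˢ-trans (resp _ _ (IsΛ-Xᴳ H (λ ())) IsΛ-1ˢ (Xᴳ-empty H)) unital
      ; Ψ-cong      = λ {_} {H} {H′} positive H≈H′ → resp _ _ (IsΛ-Xᴳ H positive) (IsΛ-Xᴳ H′ (PositiveWeights-cong H≈H′ positive))
                        (Xᴳ-cong H≈H′)
      ; Ψ-relabel   = λ π H positive → resp _ _ (IsΛ-Xᴳ (relabel (Inverse.to π) H) (PositiveWeights-relabel _ H positive))
                        (IsΛ-Xᴳ H positive) (Xᴳ-relabel π H)
      ; Ψ-cut       = λ H positive edge _ → φ∘X-cut H positive edge
      ; Ψ-isolated  = φ∘X-isolated
      }

  complementᴳ : ∀ {m} → Graph m → Graph m
  complementᴳ H = graph (λ a b → if does (a ≟ b) then false else not (adj H a b)) (wt H)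

  complementᴳ-cong : ∀ {m} {H H′ : Graph m} → H ≈ᴳ H′ → complementᴳ H ≈ᴳ complementᴳ H′
  complementᴳ-cong (same-adj , same-wt) = (λ a b → ≡.cong (λ e → if does (a ≟ b) then false else not e) (same-adj a b)) , same-wt

  complementᴳ-relabel : ∀ {m} (π : Fin m ↔ Fin m) (H : Graph m) →
    complementᴳ (relabel (Inverse.to π) H) ≈ᴳ relabel (Inverse.to π) (complementᴳ H)
  complementᴳ-relabel π H = (λ a b → ≡.cong (λ d → if d then false else not (adj H (to a) (to b)))
                                        (does-⇔ (mk⇔ (≡.cong to) injective) (a ≟ b) (to a ≟ to b)))
                          , λ a → ≡.refl
    where
    open Inverse π
    injective : ∀ {a b} → to a ≡ to b → a ≡ b
    injective {a} {b} eq = ≡.trans (≡.sym (strictlyInverseʳ a)) (≡.trans (≡.cong from eq) (strictlyInverseʳ b))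

  -- In the complement, cutting the edge 01 of H adds the edge 01, and contracting
  -- merges non-adjacency with ∨, i.e. adjacency with ∧.
  complementᴳ-cut : ∀ {m} (H : Graph (suc (suc m))) → adj H zero (suc zero) ≡ true → adj H (suc zero) zero ≡ true →
    complementᴳ H ≈ᴳ cutEdge (complementᴳ (cutEdge H))
  complementᴳ-cut H edge₀₁ edge₁₀ = same-adj , λ a → ≡.refl
    where
    same-adj : ∀ a b → adj (complementᴳ H) a b ≡ adj (cutEdge (complementᴳ (cutEdge H))) a b
    same-adj (suc a)       (suc b)       = ≡.refl
    same-adj zero          zero          = ≡.refl
    same-adj zero          (suc zero)    = ≡.cong not edge₀₁
    same-adj zero          (suc (suc b)) = ≡.refl
    same-adj (suc zero)    zero          = ≡.cong not edge₁₀
    same-adj (suc (suc a)) zero          = ≡.refl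

  complementᴳ-contract : ∀ {m} (H : Graph (suc (suc m))) →
    contract _∨_ (complementᴳ (cutEdge H)) ≈ᴳ complementᴳ (contract _∧_ H)
  complementᴳ-contract H = same-adj , λ { zero → ≡.refl ; (suc a) → ≡.refl }
    where
    de-Morgan : ∀ x y → not x ∨ not y ≡ not (x ∧ y)
    de-Morgan true  y = ≡.refl
    de-Morgan false y = ≡.refl
    same-adj : ∀ a b → adj (contract _∨_ (complementᴳ (cutEdge H))) a b ≡ adj (complementᴳ (contract _∧_ H)) a b
    same-adj zero    zero    = ≡.refl
    same-adj zero    (suc b) = de-Morgan (adj H zero (suc (suc b))) (adj H (suc zero) (suc (suc b)))
    same-adj (suc a) zero    = de-Morgan (adj H (suc (suc a)) zero) (adj H (suc (suc a)) (suc zero))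
    same-adj (suc a) (suc b) = ≡.refl

  module _ (Vs Es Cs : ℕ → Set) (θ : Series → Series) (θ-hom : IsHomΛ̃Λ̃ θ)
           (θ-VE : ∀ k → Vs k ⊎ Es k → θ (pˢ k) ≈ˢ pˢ k) (θ-C : ∀ k → Cs k → θ (pˢ k) ≈ˢ 0ˢ) where
    open IsHomΛ̃Λ̃ θ-hom

    θ∘X∘complement-cut : ∀ {m} (H : Graph (suc (suc m))) → PositiveWeights H →
      adj H zero (suc zero) ≡ true → adj H (suc zero) zero ≡ true →
      θ (Xᴳ (complementᴳ H)) ≈ˢ (θ (Xᴳ (complementᴳ (cutEdge H))) +ˢ (1# • θ (Xᴳ (complementᴳ (contract _∧_ H)))))
    θ∘X∘complement-cut H positive edge₀₁ edge₁₀ =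
      ≈ˢ-trans (resp _ _ (IsΛ-Xᴳ (complementᴳ H) positive) (IsΛ-resp split (IsΛ-Xᴳ (complementᴳ H) positive)) split)
      (≈ˢ-trans (additive _ _ (IsΛ-Xᴳ (complementᴳ (cutEdge H)) positive)
                              (IsΛ-Xᴳ (complementᴳ (contract _∧_ H)) (PositiveWeights-contract _∧_ H positive)))
                (+ˢ-cong ≈ˢ-refl (λ α → sym (*-identityˡ _))))
      where
      split : Xᴳ (complementᴳ H) ≈ˢ (Xᴳ (complementᴳ (cutEdge H)) +ˢ Xᴳ (complementᴳ (contract _∧_ H)))
      split = ≈ˢ-trans (Xᴳ-cong (complementᴳ-cut H edge₀₁ edge₁₀))
              (≈ˢ-trans (Xᴳ-deletion-contraction (complementᴳ (cutEdge H)) ≡.refl)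
                        (+ˢ-cong ≈ˢ-refl (Xᴳ-cong (complementᴳ-contract H))))

    θ∘X∘complement-isolated : ∀ {m} (H : Graph (suc m)) → PositiveWeights H → Isolated₀ H →
      ∀ a → θ (pˢ (wt H zero)) ≈ˢ (a • pˢ (wt H zero)) →
      θ (Xᴳ (complementᴳ H)) ≈ˢ (a • (pˢ (wt H zero) ⊙ θ (Xᴳ (complementᴳ (delete₀ H)))))
    θ∘X∘complement-isolated H positive isolated a θp≈ap =
      ≈ˢ-trans (resp _ _ (IsΛ-Xᴳ (complementᴳ H) positive) (IsΛ-resp factor (IsΛ-Xᴳ (complementᴳ H) positive)) factor)
      (≈ˢ-trans (multiplicative _ _ (IsΛ-p (wt H zero)) (IsΛ-Xᴳ (complementᴳ (delete₀ H)) (positive ∘ suc)))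
      (≈ˢ-trans (⊙-cong θp≈ap ≈ˢ-refl) (•-⊙ a (pˢ (wt H zero)) _)))
      where
      factor = Xᴳ-dominating (complementᴳ H) (≡.refl , λ x → ≡.cong not (proj₁ (isolated (suc x)))) positive

    θ∘X∘complement-invariant : DeletionContractionInvariant Vs Es Cs
    θ∘X∘complement-invariant = record
      { Ψ           = λ H → θ (Xᴳ (complementᴳ H))
      ; merge       = _∧_
      ; merge-false = ≡.refl
      ; merge-true⁻ = λ a b ab → inj₁ (proj₁ (∧-true⁻ {a} ab))
      ; σ           = 1#
      ; ε           = 1#
      ; σε≈1        = *-identityˡ 1#
      ; ψ           = λ k → θ (pˢ k)
      ; ψ-V         = λ k k∈V α → trans (θ-VE k (inj₁ k∈V) α) (sym (*-identityˡ _))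
      ; ψ-E         = λ k k∈E α → trans (θ-VE k (inj₂ k∈E) α) (sym (*-identityˡ _))
      ; ψ-C         = λ k k∈C α → trans (θ-C k k∈C α) (sym (zeroˡ _))
      ; Ψ-empty     = λ H → ≈ˢ-trans (resp _ _ (IsΛ-Xᴳ (complementᴳ H) (λ ())) IsΛ-1ˢ (Xᴳ-empty (complementᴳ H))) unital
      ; Ψ-cong      = λ {_} {H} {H′} positive H≈H′ → resp _ _ (IsΛ-Xᴳ (complementᴳ H) positive)
                        (IsΛ-Xᴳ (complementᴳ H′) (PositiveWeights-cong H≈H′ positive)) (Xᴳ-cong (complementᴳ-cong H≈H′))
      ; Ψ-relabel   = λ π H positive → resp _ _ (IsΛ-Xᴳ (complementᴳ (relabel (Inverse.to π) H)) (PositiveWeights-relabel _ H positive))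
                        (IsΛ-Xᴳ (complementᴳ H) positive)
                                               (≈ˢ-trans (Xᴳ-cong (complementᴳ-relabel π H)) (Xᴳ-relabel π (complementᴳ H)))
      ; Ψ-cut       = θ∘X∘complement-cut
      ; Ψ-isolated  = θ∘X∘complement-isolated
      }

module VertexSets where
  open import Data.Nat using (_+_)
  open ≡ hiding ([_])
  open ≡-Reasoning
  open Counting

  subsetSum : ∀ {N} → Subset N → (Fin N → ℕ) → ℕ
  subsetSum {N} S f = ∑ (allFin N) (λ v → if Vec.lookup S v then f v else 0)

  subsetSum-∷ : ∀ {N} x (S : Subset N) f → subsetSum (x ∷ S) f ≡ (if x then f zero else 0) + subsetSum S (f ∘ suc)
  subsetSum-∷ {N} x S f = ∑-allFin-suc N _

  subsetSum-∅ : ∀ {N} f → subsetSum (∅ {N}) f ≡ 0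
  subsetSum-∅ {zero}  f = refl
  subsetSum-∅ {suc N} f = trans (subsetSum-∷ false ∅ f) (subsetSum-∅ (f ∘ suc))

  subsetSum-⁅⁆ : ∀ {N} (z : Fin N) f → subsetSum ⁅ z ⁆ f ≡ f z
  subsetSum-⁅⁆ {suc N} zero    f = trans (subsetSum-∷ true ∅ f) (trans (cong (f zero +_) (subsetSum-∅ (f ∘ suc))) (ℕₚ.+-identityʳ _))
  subsetSum-⁅⁆ {suc N} (suc z) f = trans (subsetSum-∷ false ⁅ z ⁆ f) (subsetSum-⁅⁆ z (f ∘ suc))

  subsetSum-∪⁅⁆ : ∀ {N} (Z : Subset N) y f → y ∉ Z → subsetSum (Z ∪ ⁅ y ⁆) f ≡ subsetSum Z f + f y
  subsetSum-∪⁅⁆ (true  ∷ Z) zero    f y∉Z = contradiction here y∉Z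
  subsetSum-∪⁅⁆ (false ∷ Z) zero    f y∉Z = begin
    subsetSum (true ∷ (Z ∪ ∅)) f  ≡⟨ subsetSum-∷ true (Z ∪ ∅) f ⟩
    f zero + subsetSum (Z ∪ ∅) (f ∘ suc) ≡⟨ cong (λ S → f zero + subsetSum S (f ∘ suc)) (∪-identityʳ Z) ⟩
    f zero + subsetSum Z (f ∘ suc)       ≡⟨ ℕₚ.+-comm (f zero) _ ⟩
    subsetSum Z (f ∘ suc) + f zero       ≡⟨ cong (_+ f zero) (subsetSum-∷ false Z f) ⟨
    subsetSum (false ∷ Z) f + f zero     ∎
  subsetSum-∪⁅⁆ (x ∷ Z) (suc y) f y∉Z = begin
    subsetSum ((x ∨ false) ∷ (Z ∪ ⁅ y ⁆)) f
      ≡⟨ subsetSum-∷ (x ∨ false) (Z ∪ ⁅ y ⁆) f ⟩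
    (if x ∨ false then f zero else 0) + subsetSum (Z ∪ ⁅ y ⁆) (f ∘ suc)
      ≡⟨ cong₂ _+_ (cong (if_then f zero else 0) (∨-identityʳ x)) (subsetSum-∪⁅⁆ Z y (f ∘ suc) (y∉Z ∘ there)) ⟩
    (if x then f zero else 0) + (subsetSum Z (f ∘ suc) + f (suc y))
      ≡⟨ ℕₚ.+-assoc (if x then f zero else 0) (subsetSum Z (f ∘ suc)) (f (suc y)) ⟨
    ((if x then f zero else 0) + subsetSum Z (f ∘ suc)) + f (suc y)
      ≡⟨ cong (_+ f (suc y)) (subsetSum-∷ x Z f) ⟨
    subsetSum (x ∷ Z) f + f (suc y) ∎

  ∣∪⁅⁆∣ : ∀ {N} (Z : Subset N) y → y ∉ Z → ∣ Z ∪ ⁅ y ⁆ ∣ ≡ suc ∣ Z ∣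
  ∣∪⁅⁆∣ (true  ∷ Z) zero    y∉Z = contradiction here y∉Z
  ∣∪⁅⁆∣ (false ∷ Z) zero    y∉Z = cong (suc ∘ ∣_∣) (∪-identityʳ Z)
  ∣∪⁅⁆∣ (true  ∷ Z) (suc y) y∉Z = cong suc (∣∪⁅⁆∣ Z y (y∉Z ∘ there))
  ∣∪⁅⁆∣ (false ∷ Z) (suc y) y∉Z = ∣∪⁅⁆∣ Z y (y∉Z ∘ there)

  module _ (G : WGraph) where

    ReachIn-mono : ∀ {S S′ : Subset (n G)} → (∀ {x} → x ∈ S → x ∈ S′) → ∀ {u v} → ReachIn G S u v → ReachIn G S′ u v
    ReachIn-mono S⊆S′ here             = here
    ReachIn-mono S⊆S′ (step e x∈S rest) = step e (S⊆S′ x∈S) (ReachIn-mono S⊆S′ rest)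

    ReachIn-++ : ∀ {S u x v} → ReachIn G S u x → ReachIn G S x v → ReachIn G S u v
    ReachIn-++ here             r = r
    ReachIn-++ (step e x∈S rest) r = step e x∈S (ReachIn-++ rest r)

    connected-⁅⁆ : ∀ z → InducedConnected G ⁅ z ⁆
    connected-⁅⁆ z u v u∈ v∈ rewrite x∈⁅y⁆⇒x≡y z u∈ | x∈⁅y⁆⇒x≡y z v∈ = here

    connected-∪⁅⁆ : ∀ (Z : Subset (n G)) y z → InducedConnected G Z → z ∈ Z → adj G z y ≡ true → InducedConnected G (Z ∪ ⁅ y ⁆)
    connected-∪⁅⁆ Z y z connected z∈Z zy u v u∈ v∈ with x∈p∪q⁻ Z ⁅ y ⁆ u∈ | x∈p∪q⁻ Z ⁅ y ⁆ v∈
    ... | inj₁ u∈Z | inj₁ v∈Z = ReachIn-mono (p⊆p∪q ⁅ y ⁆) (connected u v u∈Z v∈Z)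
    ... | inj₁ u∈Z | inj₂ v∈y rewrite x∈⁅y⁆⇒x≡y y v∈y =
      ReachIn-++ (ReachIn-mono (p⊆p∪q ⁅ y ⁆) (connected u z u∈Z z∈Z)) (step zy (q⊆p∪q Z ⁅ y ⁆ (x∈⁅x⁆ y)) here)
    ... | inj₂ u∈y | inj₁ v∈Z rewrite x∈⁅y⁆⇒x≡y y u∈y =
      step (trans (adj-sym G y z) zy) (p⊆p∪q ⁅ y ⁆ z∈Z) (ReachIn-mono (p⊆p∪q ⁅ y ⁆) (connected z v z∈Z v∈Z))
    ... | inj₂ u∈y | inj₂ v∈y rewrite x∈⁅y⁆⇒x≡y y u∈y | x∈⁅y⁆⇒x≡y y v∈y = here

module Expansion {c ℓ : Level} (F : Field c ℓ) where
  open import Data.Nat using (_<_; _<?_)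
  open Field F hiding (zero)
  open SymFun F
  open Counting using (∧-true⁻)
  open Colourings
  open Series F
  open Recurrence F
  open VertexSets

  transpose₀-injective : ∀ {m} (u : Fin (suc m)) {a b} → PC.transpose zero u a ≡ PC.transpose zero u b → a ≡ b
  transpose₀-injective u eq = ≡.trans (≡.sym (PC.transpose-inverse u zero))
                                      (≡.trans (≡.cong (PC.transpose u zero) eq) (PC.transpose-inverse u zero))

  transpose₀-suc≢ : ∀ {m} (u : Fin (suc m)) x → PC.transpose zero u (suc x) ≢ u
  transpose₀-suc≢ u x eq with transpose₀-injective u {suc x} {zero} eq
  ... | ()

  toOne : ∀ {m} → Fin (suc m) → Permutation′ (suc (suc m))
  toOne u = lift₀ (transpose zero u)

  cutAt : ∀ {m} → Fin m → Graph (suc m) → Graph (suc m)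
  cutAt {m} u H = graph cut (wt H)
    where
    cut : Fin (suc m) → Fin (suc m) → Bool
    cut zero    zero    = adj H zero zero
    cut zero    (suc b) = adj H zero (suc b) ∧ not (does (b ≟ u))
    cut (suc a) zero    = adj H (suc a) zero ∧ not (does (a ≟ u))
    cut (suc a) (suc b) = adj H (suc a) (suc b)

  cutEdge-toOne : ∀ {m} (u : Fin (suc m)) (H : Graph (suc (suc m))) →
    cutEdge (relabel (Inverse.to (toOne u)) H) ≈ᴳ relabel (Inverse.to (toOne u)) (cutAt u H)
  cutEdge-toOne {m} u H = same-adj , λ a → ≡.refl
    where
    τ = PC.transpose zero u
    other : ∀ b → does (τ (suc b) ≟ u) ≡ false
    other b = dec-false (τ (suc b) ≟ u) (transpose₀-suc≢ u b)
    same-adj : ∀ a b → adj (cutEdge (relabel (Inverse.to (toOne u)) H)) a b ≡ adj (relabel (Inverse.to (toOne u)) (cutAt u H)) a b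
    same-adj (suc a)       (suc b)       = ≡.refl
    same-adj zero          zero          = ≡.refl
    same-adj zero          (suc zero)    = ≡.sym (≡.trans (≡.cong (λ d → adj H zero (suc u) ∧ not d) (dec-true (u ≟ u) ≡.refl)) (∧-zeroʳ _))
    same-adj zero          (suc (suc b)) = ≡.sym (≡.trans (≡.cong (λ d → adj H zero (suc (τ (suc b))) ∧ not d) (other b)) (∧-identityʳ _))
    same-adj (suc zero)    zero          = ≡.sym (≡.trans (≡.cong (λ d → adj H (suc u) zero ∧ not d) (dec-true (u ≟ u) ≡.refl)) (∧-zeroʳ _))
    same-adj (suc (suc a)) zero          = ≡.sym (≡.trans (≡.cong (λ d → adj H (suc (τ (suc a))) zero ∧ not d) (other a)) (∧-identityʳ _))

  ∑ˢ : ∀ k → (Fin k → Series) → Series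
  ∑ˢ zero    f = 0ˢ
  ∑ˢ (suc k) f = f zero +ˢ ∑ˢ k (f ∘ suc)

  ∑ˢ-cong : ∀ k {f g : Fin k → Series} → (∀ i → f i ≈ˢ g i) → ∑ˢ k f ≈ˢ ∑ˢ k g
  ∑ˢ-cong zero    f≈g = ≈ˢ-refl
  ∑ˢ-cong (suc k) f≈g = +ˢ-cong (f≈g zero) (∑ˢ-cong k (f≈g ∘ suc))

  ∑ˢ-zero : ∀ k {f : Fin k → Series} → (∀ i → f i ≈ˢ 0ˢ) → ∑ˢ k f ≈ˢ 0ˢ
  ∑ˢ-zero zero    f≈0 = ≈ˢ-refl
  ∑ˢ-zero (suc k) f≈0 α = trans (+-cong (f≈0 zero α) (∑ˢ-zero k (f≈0 ∘ suc) α)) (+-identityˡ 0#)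

  if-∧-true : ∀ d (S : Series) → (if d ∧ true then S else 0ˢ) ≈ˢ (if d then S else 0ˢ)
  if-∧-true d S α = reflexive (≡.cong (λ e → (if e then S else 0ˢ) α) (∧-identityʳ d))

  ∑ˢ-restore : ∀ k (b : Fin k → Bool) (T : Fin k → Series) (u : Fin k) → b u ≡ true →
    (∑ˢ k (λ v → if b v ∧ not (does (v ≟ u)) then T v else 0ˢ) +ˢ T u) ≈ˢ ∑ˢ k (λ v → if b v then T v else 0ˢ)
  ∑ˢ-restore (suc k) b T zero bu α rewrite bu = begin
    (0# + ∑ˢ k (λ v → if b (suc v) ∧ true then T (suc v) else 0ˢ) α) + T zero α
      ≈⟨ trans (+-congʳ (+-identityˡ _)) (+-comm _ _) ⟩
    T zero α + ∑ˢ k (λ v → if b (suc v) ∧ true then T (suc v) else 0ˢ) α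
      ≈⟨ +-congˡ (∑ˢ-cong k (λ v → if-∧-true (b (suc v)) (T (suc v))) α) ⟩
    T zero α + ∑ˢ k (λ v → if b (suc v) then T (suc v) else 0ˢ) α ∎
    where open import Relation.Binary.Reasoning.Setoid setoid
  ∑ˢ-restore (suc k) b T (suc u) bu α = begin
    ((if b zero ∧ true then T zero else 0ˢ) α + ∑ˢ k (λ v → if b (suc v) ∧ not (does (v ≟ u)) then T (suc v) else 0ˢ) α) + T (suc u) α
      ≈⟨ +-assoc _ _ _ ⟩
    (if b zero ∧ true then T zero else 0ˢ) α + (∑ˢ k (λ v → if b (suc v) ∧ not (does (v ≟ u)) then T (suc v) else 0ˢ) α + T (suc u) α)
      ≈⟨ +-cong (if-∧-true (b zero) (T zero) α) (∑ˢ-restore k (b ∘ suc) (T ∘ suc) u bu α) ⟩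
    (if b zero then T zero else 0ˢ) α + ∑ˢ k (λ v → if b (suc v) then T (suc v) else 0ˢ) α ∎
    where open import Relation.Binary.Reasoning.Setoid setoid

  module _ (G : WGraph) where

    record Induced {m} (H : Graph m) (ι : Fin m → Fin (n G)) : Set where
      field
        injective : ∀ i j → ι i ≡ ι j → i ≡ j
        adj-ι     : ∀ i j → adj H i j ≡ adj G (ι i) (ι j)
        wt-ι      : ∀ i → wt H i ≡ w G (ι i)

    Induced⇒PositiveWeights : ∀ {m} {H : Graph m} {ι} → Induced H ι → PositiveWeights H
    Induced⇒PositiveWeights {ι = ι} induced i = ≡.subst (1 ≤_) (≡.sym (Induced.wt-ι induced i)) (w-pos G (ι i))

    -- Vertex 0 of H is the connected vertex set Z of G contracted to a point; the other
    -- vertices are induced from G, outside Z.  Edges at vertex 0 may have been deleted, but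
    -- each remaining one comes from an edge of G leaving Z.
    record Contraction {m} (H : Graph (suc m)) (Z : Subset (n G)) (ι : Fin m → Fin (n G)) : Set where
      field
        induced      : Induced (delete₀ H) ι
        outside      : ∀ i → ι i ∉ Z
        connected    : InducedConnected G Z
        wt₀          : wt H zero ≡ weightOf G Z
        wt₀-positive : 1 ≤ wt H zero
        adj₀         : ∀ i → adj H zero (suc i) ≡ true → ∃[ z ] (z ∈ Z × adj G z (ι i) ≡ true)
        adj-sym₀     : ∀ i → adj H (suc i) zero ≡ adj H zero (suc i)
        no-loop₀     : adj H zero zero ≡ false
      open Induced induced public

    Contraction⇒PositiveWeights : ∀ {m} {H : Graph (suc m)} {Z ι} → Contraction H Z ι → PositiveWeights H
    Contraction⇒PositiveWeights C zero    = Contraction.wt₀-positive C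
    Contraction⇒PositiveWeights C (suc i) = Induced⇒PositiveWeights (Contraction.induced C) i

    Induced⇒Contraction : ∀ {m} {H : Graph (suc m)} {ι} → Induced H ι → Contraction H ⁅ ι zero ⁆ (ι ∘ suc)
    Induced⇒Contraction {H = H} {ι} induced = record
      { induced      = record { injective = λ i j eq → Finₚ.suc-injective (injective (suc i) (suc j) eq)
                              ; adj-ι     = λ i j → adj-ι (suc i) (suc j)
                              ; wt-ι      = λ i → wt-ι (suc i) }
      ; outside      = λ i i∈ → 0≢suc (injective zero (suc i) (≡.sym (x∈⁅y⁆⇒x≡y (ι zero) i∈)))
      ; connected    = connected-⁅⁆ G (ι zero)
      ; wt₀          = ≡.trans (wt-ι zero) (≡.sym (subsetSum-⁅⁆ (ι zero) (w G)))
      ; wt₀-positive = Induced⇒PositiveWeights induced zero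
      ; adj₀         = λ i e → ι zero , x∈⁅x⁆ (ι zero) , ≡.trans (≡.sym (adj-ι zero (suc i))) e
      ; adj-sym₀     = λ i → ≡.trans (adj-ι (suc i) zero) (≡.trans (adj-sym G _ _) (≡.sym (adj-ι zero (suc i))))
      ; no-loop₀     = ≡.trans (adj-ι zero zero) (adj-irrefl G (ι zero))
      }
      where
      open Induced induced
      0≢suc : ∀ {k} {i : Fin k} → zero ≢ suc i
      0≢suc ()

    Contraction-cutAt : ∀ {m} (u : Fin m) {H : Graph (suc m)} {Z ι} → Contraction H Z ι → Contraction (cutAt u H) Z ι
    Contraction-cutAt u {H} C = record
      { induced      = induced
      ; outside      = outside
      ; connected    = connected
      ; wt₀          = wt₀
      ; wt₀-positive = wt₀-positive
      ; adj₀         = λ i e → adj₀ i (proj₁ (∧-true⁻ {adj H zero (suc i)} e))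
      ; adj-sym₀     = λ i → ≡.cong (_∧ not (does (i ≟ u))) (adj-sym₀ i)
      ; no-loop₀     = no-loop₀
      }
      where open Contraction C

    merged : ∀ {m} → (Bool → Bool → Bool) → Fin (suc m) → Graph (suc (suc m)) → Graph (suc m)
    merged op u H = contract op (relabel (Inverse.to (toOne u)) H)

    Induced-merged : ∀ {m} op (u : Fin (suc m)) {H : Graph (suc (suc m))} {ι} → Induced (delete₀ H) ι →
      Induced (delete₀ (merged op u H)) (ι ∘ PC.transpose zero u ∘ suc)
    Induced-merged op u induced = record
      { injective = λ i j eq → Finₚ.suc-injective (transpose₀-injective u (injective _ _ eq))
      ; adj-ι     = λ i j → adj-ι (PC.transpose zero u (suc i)) (PC.transpose zero u (suc j))
      ; wt-ι      = λ i → wt-ι (PC.transpose zero u (suc i))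
      }
      where open Induced induced

    module _ {m} (op : Bool → Bool → Bool) (op-false : op false false ≡ false)
             (op-true⁻ : ∀ a b → op a b ≡ true → a ≡ true ⊎ b ≡ true)
             (u : Fin (suc m)) {H : Graph (suc (suc m))} {Z ι} (C : Contraction H Z ι) (edge : adj H zero (suc u) ≡ true) where
      open Contraction C
      private
        τ = PC.transpose zero u

      Contraction-merged : Contraction (merged op u H) (Z ∪ ⁅ ι u ⁆) (ι ∘ τ ∘ suc)
      Contraction-merged = record
        { induced      = Induced-merged op u {H} induced
        ; outside      = outside′
        ; connected    = connected-∪⁅⁆ G Z (ι u) z connected z∈Z zu
        ; wt₀          = ≡.trans (≡.cong₂ ℕ._+_ wt₀ (wt-ι u)) (≡.sym (subsetSum-∪⁅⁆ Z (ι u) (w G) (outside u)))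
        ; wt₀-positive = ℕₚ.≤-trans wt₀-positive (ℕₚ.m≤m+n _ _)
        ; adj₀         = λ i e → adj₀′ i (op-true⁻ _ _ e)
        ; adj-sym₀     = λ i → ≡.cong₂ op (adj-sym₀ (τ (suc i))) (symmetric (τ (suc i)) u)
        ; no-loop₀     = ≡.trans (≡.cong₂ op no-loop₀ (≡.trans (adj-ι u u) (adj-irrefl G (ι u)))) op-false
        }
        where
        z   = proj₁ (adj₀ u edge)
        z∈Z = proj₁ (proj₂ (adj₀ u edge))
        zu  = proj₂ (proj₂ (adj₀ u edge))
        symmetric : ∀ a b → adj H (suc a) (suc b) ≡ adj H (suc b) (suc a)
        symmetric a b = ≡.trans (adj-ι a b) (≡.trans (adj-sym G (ι a) (ι b)) (≡.sym (adj-ι b a)))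
        outside′ : ∀ i → ι (τ (suc i)) ∉ Z ∪ ⁅ ι u ⁆
        outside′ i ∈ with x∈p∪q⁻ Z ⁅ ι u ⁆ ∈
        ... | inj₁ ∈Z = outside (τ (suc i)) ∈Z
        ... | inj₂ ∈u = transpose₀-suc≢ u i (injective _ _ (x∈⁅y⁆⇒x≡y (ι u) ∈u))
        adj₀′ : ∀ i → adj H zero (suc (τ (suc i))) ≡ true ⊎ adj H (suc u) (suc (τ (suc i))) ≡ true →
                ∃[ z ] (z ∈ Z ∪ ⁅ ι u ⁆ × adj G z (ι (τ (suc i))) ≡ true)
        adj₀′ i (inj₁ e) with adj₀ (τ (suc i)) e
        ... | z′ , z′∈Z , z′i = z′ , p⊆p∪q ⁅ ι u ⁆ z′∈Z , z′i
        adj₀′ i (inj₂ e) = ι u , q⊆p∪q Z ⁅ ι u ⁆ (x∈⁅x⁆ (ι u)) , ≡.trans (≡.sym (adj-ι u (τ (suc i)))) e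

  data Size : Set where
    single pair large : Size

  grow : Size → Size
  grow single = pair
  grow pair   = large
  grow large  = large

  module _ (G : WGraph) (Es : ℕ → Set) where

    HasSize : Size → Subset (n G) → Set
    HasSize single Z = ∃[ z ] (Z ≡ ⁅ z ⁆)
    HasSize pair   Z = ∣ Z ∣ ≡ 2 × Es (weightOf G Z)
    HasSize large  Z = 3 ≤ ∣ Z ∣

    HasSize-grow : (∀ u v → adj G u v ≡ true → Es (w G u ℕ.+ w G v)) →
      ∀ s {Z y z} → y ∉ Z → z ∈ Z → adj G z y ≡ true → HasSize s Z → HasSize (grow s) (Z ∪ ⁅ y ⁆)
    HasSize-grow weights-E single {Z} {y} {z} y∉Z z∈Z zy (z₀ , ≡.refl) = size , ≡.subst Es (≡.sym weight) (weights-E z₀ y z₀y)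
      where
      size : ∣ Z ∪ ⁅ y ⁆ ∣ ≡ 2
      size = ≡.trans (∣∪⁅⁆∣ Z y y∉Z) (≡.cong suc (∣⁅x⁆∣≡1 z₀))
      weight : weightOf G (Z ∪ ⁅ y ⁆) ≡ w G z₀ ℕ.+ w G y
      weight = ≡.trans (subsetSum-∪⁅⁆ Z y (w G) y∉Z) (≡.cong (ℕ._+ w G y) (subsetSum-⁅⁆ z₀ (w G)))
      z₀y : adj G z₀ y ≡ true
      z₀y = ≡.subst (λ x → adj G x y ≡ true) (x∈⁅y⁆⇒x≡y z₀ z∈Z) zy
    HasSize-grow weights-E pair  {Z} {y} y∉Z _ _ (size , _) = ℕₚ.≤-reflexive (≡.sym (≡.trans (∣∪⁅⁆∣ Z y y∉Z) (≡.cong suc size)))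
    HasSize-grow weights-E large {Z} {y} y∉Z _ _ 3≤∣Z∣ =
      ≡.subst (3 ≤_) (≡.sym (∣∪⁅⁆∣ Z y y∉Z)) (ℕₚ.≤-trans 3≤∣Z∣ (ℕₚ.n≤1+n _))

  module ExpansionOf (G : WGraph) (Vs Es Cs : ℕ → Set)
           (weights-V : ∀ v → Vs (w G v))
           (weights-E : ∀ u v → adj G u v ≡ true → Es (w G u ℕ.+ w G v))
           (weights-C : ∀ (S : Subset (n G)) → 3 ≤ ∣ S ∣ → InducedConnected G S → Cs (weightOf G S))
           (I : DeletionContractionInvariant Vs Es Cs) where
    open DeletionContractionInvariant I

    coefficient : Size → Carrier
    coefficient single = 1#
    coefficient pair   = ε
    coefficient large  = 0#

    ψ-coefficient : ∀ {m} s {H : Graph (suc m)} {Z ι} → Contraction G H Z ι → HasSize G Es s Z →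
      ψ (wt H zero) ≈ˢ (coefficient s • pˢ (wt H zero))
    ψ-coefficient single C (z , ≡.refl) =
      ψ-V _ (≡.subst Vs (≡.sym (≡.trans (Contraction.wt₀ C) (subsetSum-⁅⁆ z (w G)))) (weights-V z))
    ψ-coefficient pair  C (_ , Es-weight) = ψ-E _ (≡.subst Es (≡.sym (Contraction.wt₀ C)) Es-weight)
    ψ-coefficient large C 3≤∣Z∣ = ψ-C _ (≡.subst Cs (≡.sym (Contraction.wt₀ C)) (weights-C _ 3≤∣Z∣ (Contraction.connected C)))

    neighbourTerm : ∀ {m} → Graph (suc (suc m)) → Fin (suc m) → Series
    neighbourTerm H u = pˢ (wt H zero ℕ.+ wt H (suc u)) ⊙ Ψ (delete₀ (merged G merge u H))

    neighbourSum : ∀ {m} → Graph (suc m) → Series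
    neighbourSum {zero}  H = 0ˢ
    neighbourSum {suc m} H = ∑ˢ (suc m) (λ u → if adj H zero (suc u) then neighbourTerm H u else 0ˢ)

    neighbourSum-no-edges : ∀ {m} (H : Graph (suc m)) → (∀ i → adj H zero (suc i) ≡ false) → neighbourSum H ≈ˢ 0ˢ
    neighbourSum-no-edges {zero}  H no-edge = ≈ˢ-refl
    neighbourSum-no-edges {suc m} H no-edge =
      ∑ˢ-zero (suc m) (λ i → ≡.subst (λ b → (if b then neighbourTerm H i else 0ˢ) ≈ˢ 0ˢ) (≡.sym (no-edge i)) ≈ˢ-refl)

    neighbourTerms : ∀ {m} → Size → Graph (suc m) → Series
    neighbourTerms single H = neighbourSum H
    neighbourTerms pair   H = 0ˢ
    neighbourTerms large  H = 0ˢ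

    -- Ψ H once every edge at vertex 0 has been deleted or contracted
    expansion : ∀ {m} → Size → Graph (suc m) → Series
    expansion s H = (coefficient s • (pˢ (wt H zero) ⊙ Ψ (delete₀ H))) +ˢ neighbourTerms s H

    expand-isolated : ∀ {m} s (H : Graph (suc m)) {Z ι} → Contraction G H Z ι → HasSize G Es s Z →
      (∀ i → adj H zero (suc i) ≡ false) → Ψ H ≈ˢ expansion s H
    expand-isolated {m} s H C size no-edge =
      ≈ˢ-trans (Ψ-isolated H (Contraction⇒PositiveWeights G C) isolated (coefficient s) (ψ-coefficient s C size))
               (λ α → trans (sym (+-identityʳ _)) (+-congˡ (sym (no-neighbours s α))))
      where
      open Contraction C
      isolated : Isolated₀ H
      isolated zero    = no-loop₀ , no-loop₀
      isolated (suc i) = no-edge i , ≡.trans (adj-sym₀ i) (no-edge i)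
      no-neighbours : ∀ s → neighbourTerms s H ≈ˢ 0ˢ
      no-neighbours single = neighbourSum-no-edges H no-edge
      no-neighbours pair  = ≈ˢ-refl
      no-neighbours large = ≈ˢ-refl

    recombine-single : ∀ {A S′ S T Y : Series} → (S′ +ˢ T) ≈ˢ S → Y ≈ˢ ((ε • T) +ˢ 0ˢ) → ((A +ˢ S′) +ˢ (σ • Y)) ≈ˢ (A +ˢ S)
    recombine-single {A} {S′} {S} {T} {Y} S′+T≈S Y≈εT α = begin
      (A α + S′ α) + σ * Y α               ≈⟨ +-congˡ (*-congˡ (trans (Y≈εT α) (+-identityʳ _))) ⟩
      (A α + S′ α) + σ * (ε * T α)         ≈⟨ +-congˡ (sym (*-assoc _ _ _)) ⟩
      (A α + S′ α) + (σ * ε) * T α         ≈⟨ +-congˡ (trans (*-congʳ σε≈1) (*-identityˡ _)) ⟩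
      (A α + S′ α) + T α                   ≈⟨ +-assoc _ _ _ ⟩
      A α + (S′ α + T α)                   ≈⟨ +-congˡ (S′+T≈S α) ⟩
      A α + S α                            ∎
      where open import Relation.Binary.Reasoning.Setoid setoid

    recombine-larger : ∀ {A X Y : Series} → Y ≈ˢ ((0# • X) +ˢ 0ˢ) → ((A +ˢ 0ˢ) +ˢ (σ • Y)) ≈ˢ (A +ˢ 0ˢ)
    recombine-larger Y≈0 α =
      trans (+-congˡ (trans (*-congˡ (trans (Y≈0 α) (trans (+-identityʳ _) (zeroˡ _)))) (zeroʳ σ))) (+-identityʳ _)

    expand-step : ∀ {m} s (H : Graph (suc (suc m))) {Z ι} → Contraction G H Z ι → ∀ u → adj H zero (suc u) ≡ true →
      Ψ (cutAt u H) ≈ˢ expansion s (cutAt u H) →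
      Ψ (merged G merge u H) ≈ˢ expansion (grow s) (merged G merge u H) →
      Ψ H ≈ˢ expansion s H
    expand-step {m} s H C u edge cut-expands merged-expands = begin
      Ψ H                                                        ≈⟨ Ψ-relabel (toOne u) H positive ⟨
      Ψ H′                                                       ≈⟨ Ψ-cut H′ (PositiveWeights-relabel _ H positive) edge (≡.trans (Contraction.adj-sym₀ C u) edge) ⟩
      Ψ (cutEdge H′) +ˢ (σ • Ψ M)                                ≈⟨ +ˢ-cong cut-relabel ≈ˢ-refl ⟩
      Ψ (cutAt u H) +ˢ (σ • Ψ M)                                 ≈⟨ +ˢ-cong cut-expands (•-cong refl merged-expands) ⟩
      expansion s (cutAt u H) +ˢ (σ • expansion (grow s) M)     ≈⟨ recombine s ⟩
      expansion s H                                              ∎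
      where
      open import Relation.Binary.Reasoning.Setoid Seriesₛ
      H′ = relabel (Inverse.to (toOne u)) H
      M = merged G merge u H
      positive = Contraction⇒PositiveWeights G C
      cut-relabel : Ψ (cutEdge H′) ≈ˢ Ψ (cutAt u H)
      cut-relabel = ≈ˢ-trans (Ψ-cong (PositiveWeights-relabel _ H positive) (cutEdge-toOne u H))
                             (Ψ-relabel (toOne u) (cutAt u H) positive)
      recombine : ∀ s → (expansion s (cutAt u H) +ˢ (σ • expansion (grow s) M)) ≈ˢ expansion s H
      recombine single = recombine-single (∑ˢ-restore (suc m) (λ v → adj H zero (suc v)) (neighbourTerm H) u edge) ≈ˢ-refl
      recombine pair   = recombine-larger ≈ˢ-refl
      recombine large  = recombine-larger ≈ˢ-refl

    expand-below : ∀ m → (∀ s (H : Graph (suc m)) {Z ι} → Contraction G H Z ι → HasSize G Es s Z → Ψ H ≈ˢ expansion s H) →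
      ∀ b s (H : Graph (suc (suc m))) {Z ι} → Contraction G H Z ι → HasSize G Es s Z →
      (∀ i → adj H zero (suc i) ≡ true → Fin.toℕ i < b) → Ψ H ≈ˢ expansion s H
    expand-below m expand-smaller zero s H C size below = expand-isolated s H C size no-edge
      where
      no-edge : ∀ i → adj H zero (suc i) ≡ false
      no-edge i with adj H zero (suc i) in e
      ... | false = ≡.refl
      ... | true with () ← below i e
    expand-below m expand-smaller (suc b) s H C size below with b <? suc m
    ... | no b≮ = expand-below m expand-smaller b s H C size (λ i e → ℕₚ.<-≤-trans (Finₚ.toℕ<n i) (ℕₚ.≮⇒≥ b≮))
    ... | yes b< = by-edge (adj H zero (suc u)) ≡.refl
      where
      open Contraction C
      u = Fin.fromℕ< b<
      below-u : ∀ i → adj H zero (suc i) ≡ true → i ≢ u → Fin.toℕ i < b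
      below-u i e i≢u = ℕₚ.≤∧≢⇒< (ℕₚ.≤-pred (below i e))
                          (λ eq → i≢u (Finₚ.toℕ-injective (≡.trans eq (≡.sym (Finₚ.toℕ-fromℕ< b<)))))
      by-edge : ∀ x → adj H zero (suc u) ≡ x → Ψ H ≈ˢ expansion s H
      by-edge false no-edge = expand-below m expand-smaller b s H C size
        (λ i e → below-u i e (λ { ≡.refl → contradiction (≡.trans (≡.sym e) no-edge) λ () }))
      by-edge true edge = expand-step s H C u edge
        (expand-below m expand-smaller b s (cutAt u H) (Contraction-cutAt G u C) size below-cut)
        (expand-smaller (grow s) (merged G merge u H) (Contraction-merged G merge merge-false merge-true⁻ u C edge)
                        (HasSize-grow G Es weights-E s (outside u) z∈Z zu size))
        where
        z∈Z = proj₁ (proj₂ (adj₀ u edge))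
        zu  = proj₂ (proj₂ (adj₀ u edge))
        below-cut : ∀ i → adj (cutAt u H) zero (suc i) ≡ true → Fin.toℕ i < b
        below-cut i e with ∧-true⁻ {adj H zero (suc i)} e
        ... | e₀ , i≢u = below-u i e₀ (λ { ≡.refl → contradiction (≡.trans (≡.sym i≢u) (≡.cong not (dec-true (i ≟ i) ≡.refl))) λ () })

    expand : ∀ {m} s (H : Graph (suc m)) {Z ι} → Contraction G H Z ι → HasSize G Es s Z → Ψ H ≈ˢ expansion s H
    expand {zero}  s H C size = expand-isolated s H C size (λ ())
    expand {suc m} s H C size = expand-below m (λ s′ H′ → expand s′ H′) (suc m) s H C size (λ i _ → Finₚ.toℕ<n i)

module Agreement {c ℓ : Level} (F : Field c ℓ) (G : WGraph) (Vs Es Cs : ℕ → Set)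
  (weights-V : ∀ v → Vs (w G v))
  (weights-E : ∀ u v → adj G u v ≡ true → Es (w G u ℕ.+ w G v))
  (weights-C : ∀ (S : Subset (n G)) → 3 ≤ ∣ S ∣ → InducedConnected G S → Cs (weightOf G S))
  (I J : Recurrence.DeletionContractionInvariant F Vs Es Cs) where
  open Field F hiding (zero)
  open SymFun F
  open Colourings
  open Series F
  open Recurrence F
  open Expansion F
  module ℐ = DeletionContractionInvariant I
  module 𝒥 = DeletionContractionInvariant J
  module ℐ-expansion = Expansion.ExpansionOf F G Vs Es Cs weights-V weights-E weights-C I
  module 𝒥-expansion = Expansion.ExpansionOf F G Vs Es Cs weights-V weights-E weights-C J

  ifˢ-cong : ∀ b {S S′ : Series} → S ≈ˢ S′ → (if b then S else 0ˢ) ≈ˢ (if b then S′ else 0ˢ)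
  ifˢ-cong true  S≈S′ = S≈S′
  ifˢ-cong false S≈S′ = ≈ˢ-refl

  -- Both invariants expand at vertex 0 into the same terms, which involve only smaller induced subgraphs.
  agree : ∀ {m} (H : Graph m) {ι} → Induced G H ι → ℐ.Ψ H ≈ˢ 𝒥.Ψ H
  agree {zero}  H induced = ≈ˢ-trans (ℐ.Ψ-empty H) (≈ˢ-sym (𝒥.Ψ-empty H))
  agree {suc m} H {ι} induced = begin
    ℐ.Ψ H                           ≈⟨ ℐ-expansion.expand single H C (ι zero , ≡.refl) ⟩
    ℐ-expansion.expansion single H  ≈⟨ +ˢ-cong (•-cong refl (⊙-cong (≈ˢ-refl {pˢ (wt H zero)}) (agree (delete₀ H) (Contraction.induced C))))
                                               (neighbours-agree H (Contraction.induced C)) ⟩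
    𝒥-expansion.expansion single H  ≈⟨ 𝒥-expansion.expand single H C (ι zero , ≡.refl) ⟨
    𝒥.Ψ H                           ∎
    where
    open import Relation.Binary.Reasoning.Setoid Seriesₛ
    C = Induced⇒Contraction G {H = H} induced
    neighbours-agree : ∀ {m} (H : Graph (suc m)) {ι} → Induced G (delete₀ H) ι →
      ℐ-expansion.neighbourSum H ≈ˢ 𝒥-expansion.neighbourSum H
    neighbours-agree {zero}  H induced = ≈ˢ-refl
    neighbours-agree {suc m} H induced = ∑ˢ-cong (suc m) (λ u → ifˢ-cong (adj H zero (suc u))
      (⊙-cong (≈ˢ-refl {pˢ (wt H zero ℕ.+ wt H (suc u))}) (agree (delete₀ (merged G ℐ.merge u H)) (Induced-merged G ℐ.merge u {H} induced))))

open import Data.Nat using (_+_)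

-- Characteristic zero, positivity and disjointness of V, E, C, and the values of φ and θ
-- on other power sums are not needed: only p_w for weights w of connected vertex sets occur.
proposition6p5p1 : ∀ {c ℓ : Level} (F : Field c ℓ) → FieldOps.CharZero F →
  let open Field F using (Carrier)
      open SymFun F
      open Chromatic F
  in
  (Vs Es Cs : ℕ → Set) →
  (∀ k → Vs k → 1 ≤ k) → (∀ k → Es k → 1 ≤ k) → (∀ k → Cs k → 1 ≤ k) →
  (∀ k → Vs k → Es k → ⊥) → (∀ k → Vs k → Cs k → ⊥) → (∀ k → Es k → Cs k → ⊥) →
  (φ θ : Series → Series) → IsHomΛΛ̃ φ → IsHomΛ̃Λ̃ θ →
  (∀ k → Vs k → φ (pˢ k) ≈ˢ pˢ k) →
  (∀ k → Es k → φ (pˢ k) ≈ˢ -ˢ pˢ k) →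
  (∀ k → Cs k → φ (pˢ k) ≈ˢ 0ˢ) →
  (∀ k → 1 ≤ k → ∃ λ (a : Carrier) → φ (pˢ k) ≈ˢ a • pˢ k) →
  (∀ k → Vs k ⊎ Es k → θ (pˢ k) ≈ˢ pˢ k) →
  (∀ k → Cs k → θ (pˢ k) ≈ˢ 0ˢ) →
  (∀ k → 1 ≤ k → ∃ λ (a : Carrier) → θ (pˢ k) ≈ˢ a • pˢ k) →
  (G : WGraph) →
  (∀ v → Vs (w G v)) →
  (∀ u v → adj G u v ≡ true → Es (w G u + w G v)) →
  (∀ (S : Subset (n G)) → 3 ≤ ∣ S ∣ → InducedConnected G S → Cs (weightOf G S)) →
  φ (X G) ≈ˢ θ (X (complement G))
proposition6p5p1 F _ Vs Es Cs _ _ _ _ _ _ φ θ φ-hom θ-hom φ-V φ-E φ-C _ θ-VE θ-C _ G weights-V weights-E weights-C =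
  ≈ˢ-trans (agree Gᴳ G-induced)
           (SymFun.IsHomΛ̃Λ̃.resp θ-hom _ _ (IsΛ-Xᴳ (complementᴳ Gᴳ) (w-pos G)) (IsΛ-Xᴳ Ḡᴳ (w-pos G)) (Xᴳ-cong complements))
  where
  open Colourings
  open Series F
  open Recurrence F
  open Expansion F using (Induced)
  open Agreement F G Vs Es Cs weights-V weights-E weights-C
    (φ∘X-invariant Vs Es Cs φ φ-hom φ-V φ-E φ-C) (θ∘X∘complement-invariant Vs Es Cs θ θ-hom θ-VE θ-C)
  Gᴳ Ḡᴳ : Graph (n G)
  Gᴳ = graph (adj G) (w G)
  Ḡᴳ = graph (compAdj G) (w G)
  G-induced : Induced G Gᴳ id
  G-induced = record { injective = λ _ _ eq → eq ; adj-ι = λ _ _ → ≡.refl ; wt-ι = λ _ → ≡.refl }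
  complements : complementᴳ Gᴳ ≈ᴳ Ḡᴳ
  complements = (λ a b → same-adj a b) , λ _ → ≡.refl
    where
    same-adj : ∀ a b → (if does (a ≟ b) then false else not (adj G a b)) ≡ compAdj G a b
    same-adj a b with a ≟ b
    ... | yes _ = ≡.refl
    ... | no _  = ≡.refl
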